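{- A sequence $(k;a_1,\dots,a_n;b,\beta)$ of non-negative integers is the generalized inversion table of some unique $(N,E)\in\mathcal{N}_{n,1}$ if and only if (1) $3\le k\le n$; (2) $0\le a_i\le i-1$ for all $1\le i\le n$; (3) $a_{k-1}<a_k$; (4) $a_{k-1}+\beta<a_k+b\le k-2$.
   Context: An alternating sign matrix (ASM) of order $n$ is an $n\times n$ matrix with entries in $\{1,0,-1\}$ such that in every row and every column the nonzero entries alternate in sign, beginning and ending with $1$. Rows are numbered $1,\dots,n$ top to bottom, columns left to right; "below" means larger row index. $\mathcal{A}_{n,1}$ is the set of order-$n$ ASMs with exactly one $-1$. For $A\in\mathcal{A}_{n,1}$: opening column = column of the $-1$; opening row = row of the highest $1$ in the opening column; closing row = row of the $-1$. Left/right side: columns strictly left/right of the opening column. The closing row has exactly two $1$'s, one on each side; the right one is the closing $1$ and its column is the closing column. $A$ is neutral if the closing row is immediately below the opening row; $\mathcal{A}_{n,1}^{0}$ is the set of neutral elements. For $N\in\mathcal{A}_{n,1}^{0}$: the leading $1$ is the highest $1$ of the left side strictly below the opening row, its column the leading column; $\ell(N)$ is the sum of the entries strictly below the opening row and strictly between the leading and opening columns; $c(N)$ is the sum of the entries strictly below the closing row and strictly between the opening and closing columns. $\mathcal{N}_{n,1}=\{(N,E): N\in\mathcal{A}_{n,1}^{0},\ E\in\mathbb{Z},\ -\ell(N)\le E\le c(N)\}$. Generalized inversion table: for $(N,E)\in\mathcal{N}_{n,1}$, let $n+1-k$ be the index of the opening row of $N$ (so the closing row has index $n+2-k$). For $1\le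 i\le n$, $a_i$ is the sum of the entries of $N$ that lie strictly below row $n+1-i$ and strictly to the left of the unique $1$ of that row (for $i=k-1$, i.e. the closing row, to the left of the leftmost $1$ of that row). Let $b=c(N)$ and $\beta=E+\ell(N)$. The generalized inversion table of $(N,E)$ is $(k;a_1,\dots,a_n;b,\beta)$. -}

module Defs where

open import Data.Nat using (ℕ; zero; suc; _+_; _∸_; _≤_; _<_)
open import Data.Integer as ℤ using (ℤ; +_; 0ℤ; 1ℤ; -1ℤ)
open import Data.Fin as Fin using (Fin; toℕ; opposite)
open import Data.List using (List; []; _∷_; map; filter; foldr; allFin)
open import Data.Bool using (Bool; _∧_; if_then_else_)
open import Data.Product using (Σ; _×_; ∃; _,_)
open import Data.Sum using (_⊎_)
open import Relation.Nullary using (¬_)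
open import Relation.Nullary.Decidable using (⌊_⌋; ¬?)
open import Relation.Binary.PropositionalEquality using (_≡_; _≢_)

-- An n×n matrix with integer entries; rows and columns are indexed by Fin n,
-- where index i : Fin n corresponds to the paper's row/column number toℕ i + 1.
Matrix : ℕ → Set
Matrix n = Fin n → Fin n → ℤ

data Alternating : List ℤ → Set where
  single : Alternating (1ℤ ∷ [])
  step   : ∀ {xs} → Alternating xs → Alternating (1ℤ ∷ -1ℤ ∷ xs)

nonzeros : List ℤ → List ℤ
nonzeros = filter (λ x → ¬? (x ℤ.≟ 0ℤ))

rowList : ∀ {n} → Matrix n → Fin n → List ℤ
rowList {n} A i = map (A i) (allFin n)

colList : ∀ {n} → Matrix n → Fin n → List ℤ
colList {n} A j = map (λ i → A i j) (allFin n)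

IsASM : ∀ {n} → Matrix n → Set
IsASM A =
  (∀ i j → (A i j ≡ 1ℤ ⊎ A i j ≡ 0ℤ) ⊎ A i j ≡ -1ℤ) ×
  (∀ i → Alternating (nonzeros (rowList A i))) ×
  (∀ j → Alternating (nonzeros (colList A j)))

OneNegAt : ∀ {n} → Matrix n → Fin n → Fin n → Set
OneNegAt A r c = A r c ≡ -1ℤ × (∀ i j → A i j ≡ -1ℤ → i ≡ r × j ≡ c)

HighestOneInCol : ∀ {n} → Matrix n → Fin n → Fin n → Set
HighestOneInCol A c o = A o c ≡ 1ℤ × (∀ i → i Fin.< o → A i c ≢ 1ℤ)

LeadingOneAt : ∀ {n} → Matrix n → Fin n → Fin n → Fin n → Fin n → Set
LeadingOneAt A o c p q =
  o Fin.< p × q Fin.< c × A p q ≡ 1ℤ ×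
  (∀ i j → o Fin.< i → i Fin.< p → j Fin.< c → A i j ≢ 1ℤ)

ClosingOneAt : ∀ {n} → Matrix n → Fin n → Fin n → Fin n → Set
ClosingOneAt A r c cc = c Fin.< cc × A r cc ≡ 1ℤ

LeftmostOneAt : ∀ {n} → Matrix n → Fin n → Fin n → Set
LeftmostOneAt A R x = A R x ≡ 1ℤ × (∀ j → j Fin.< x → A R j ≢ 1ℤ)

sumℤ : List ℤ → ℤ
sumℤ = foldr ℤ._+_ 0ℤ

regionSum : ∀ {n} → Matrix n → (Fin n → Fin n → Bool) → ℤ
regionSum {n} A P =
  sumℤ (map (λ i → sumℤ (map (λ j → if P i j then A i j else 0ℤ) (allFin n))) (allFin n))

_<ᵇ_ : ∀ {n} → Fin n → Fin n → Bool
i <ᵇ j = ⌊ i Fin.<? j ⌋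

ellVal : ∀ {n} → Matrix n → (o c q : Fin n) → ℤ
ellVal A o c q = regionSum A (λ i j → (o <ᵇ i) ∧ ((q <ᵇ j) ∧ (j <ᵇ c)))

cVal : ∀ {n} → Matrix n → (r c cc : Fin n) → ℤ
cVal A r c cc = regionSum A (λ i j → (r <ᵇ i) ∧ ((c <ᵇ j) ∧ (j <ᵇ cc)))

belowLeft : ∀ {n} → Matrix n → (R x : Fin n) → ℤ
belowLeft A R x = regionSum A (λ i j → (R <ᵇ i) ∧ (j <ᵇ x))

-- The sequence a_1..a_n is given as a : Fin n → ℕ with a i = a_{toℕ i + 1};
-- the row of the paper with index n+1-i (i = toℕ j + 1) is opposite j.
record HasGIT {n : ℕ} (N : Matrix n) (E : ℤ)
              (k : ℕ) (a : Fin n → ℕ) (b β : ℕ) : Set where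
  field
    asm       : IsASM N
    r c       : Fin n
    oneNeg    : OneNegAt N r c
    o         : Fin n
    opening   : HighestOneInCol N c o
    neutral   : toℕ r ≡ suc (toℕ o)
    p q cc    : Fin n
    leading   : LeadingOneAt N o c p q
    closing   : ClosingOneAt N r c cc
    E-lower   : ℤ.- ellVal N o c q ℤ.≤ E
    E-upper   : E ℤ.≤ cVal N r c cc
    -- opening row has (paper) index n+1-k
    k-val     : k + toℕ o ≡ n
    a-val     : ∀ j → Σ (Fin n) λ x →
                  LeftmostOneAt N (opposite j) x × (+ a j ≡ belowLeft N (opposite j) x)
    b-val     : + b ≡ cVal N r c cc
    β-val     : + β ≡ E ℤ.+ ellVal N o c q

GITConditions : (n k : ℕ) → (Fin n → ℕ) → ℕ → ℕ → Set
GITConditions n k a b β =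
  (3 ≤ k × k ≤ n) ×
  (∀ i → a i ≤ toℕ i) ×
  (∀ i j → suc (suc (toℕ i)) ≡ k → suc (toℕ j) ≡ k →
     a i < a j × (a i + β < a j + b × a j + b ≤ k ∸ 2))

{-# OPTIONS --safe #-}
module Submission where

-- Read the matrix from the top. Partial column sums of an alternating sign matrix are 0 or 1,
-- so below each row they mark the columns that are still available. Every row other than the
-- closing row is a unit vector, and a_i counts the available columns to the left of its 1: the
-- table is a Lehmer code of the rows. Neutrality puts the opening row directly above the closing
-- row, whose entries 1, -1, 1 at columns q < c < cc use up q and cc and give column c back.
-- Counting available columns below the closing row gives a_k = a_(k-1) + 1 + ℓ(N) and
-- a_k + c(N) ≤ k - 2, and -ℓ(N) ≤ E ≤ c(N) gives the rest of (1)-(4). Conversely, the counts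
-- fix each row from the rows above it, which proves uniqueness, and choosing the 1s by the same
-- counts builds the matrix.

open import Defs
import Data.Integer.Properties as ℤₚ
open import Algebra.Properties.CommutativeMonoid.Sum ℤₚ.+-0-commutativeMonoid
  using (sum; sum-cong-≗; ∑-comm; sum-replicate-zero)
open import Data.Bool.Base using (Bool; true; false; T; _∧_; if_then_else_)
open import Data.Bool.Properties using (T-≡; T-∧)
open import Data.Empty using (⊥-elim)
open import Data.Fin.Base as Fin using (Fin; zero; suc; toℕ; fromℕ<; opposite)
import Data.Fin.Induction as Finᵢ
import Data.Fin.Properties as Finₚ
open import Data.Integer.Base as ℤ using (ℤ; +_; 0ℤ; 1ℤ; -1ℤ; _+_; _-_; -_; _≤_; _<_)
open import Data.Integer.Tactic.RingSolver using (solve-∀)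
open import Data.List.Base using (List; []; _∷_; map; tabulate; allFin)
import Data.List.Properties as Listₚ
open import Data.Nat.Base as ℕ using (ℕ; zero; suc; z≤n; s≤s; _∸_)
import Data.Nat.Properties as ℕₚ
import Data.Nat.Tactic.RingSolver as ℕ-Solver
open import Data.Product.Base using (Σ; ∃; ∃₂; _×_; _,_; proj₁; proj₂)
open import Data.Sum.Base using (_⊎_; inj₁; inj₂)
open import Function.Base using (id; _∘_)
open import Function.Bundles using (_⇔_; mk⇔; module Equivalence)
open import Induction.WellFounded using (module All)
open import Level using (0ℓ)
open import Relation.Binary.Definitions using (tri<; tri≈; tri>)
open import Relation.Binary.PropositionalEquality
open import Relation.Nullary using (yes; no; does)
open import Relation.Nullary.Decidable using (isYes≗does; dec-true; dec-false)

private
  variable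
    n : ℕ

-- Finite sums

when : Bool → ℤ → ℤ
when b x = if b then x else 0ℤ

sumWhere : (Fin n → Bool) → (Fin n → ℤ) → ℤ
sumWhere P f = sum (λ j → when (P j) (f j))

sum< : ℕ → (Fin n → ℤ) → ℤ
sum< v = sumWhere (λ j → toℕ j ℕ.<ᵇ v)

sum> : ℕ → (Fin n → ℤ) → ℤ
sum> u = sumWhere (λ j → u ℕ.<ᵇ toℕ j)

sumBetween : ℕ → ℕ → (Fin n → ℤ) → ℤ
sumBetween u v = sumWhere (λ j → (u ℕ.<ᵇ toℕ j) ∧ (toℕ j ℕ.<ᵇ v))

sumℤ-allFin : (f : Fin n → ℤ) → sumℤ (map f (allFin n)) ≡ sum f
sumℤ-allFin f = trans (cong sumℤ (Listₚ.map-tabulate id f)) (sumℤ-tabulate f)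
  where
  sumℤ-tabulate : ∀ {n} (f : Fin n → ℤ) → sumℤ (tabulate f) ≡ sum f
  sumℤ-tabulate {zero}  f = refl
  sumℤ-tabulate {suc n} f = cong (_+_ (f zero)) (sumℤ-tabulate (f ∘ suc))

sum-zero : ∀ n → sum {n} (λ _ → 0ℤ) ≡ 0ℤ
sum-zero = sum-replicate-zero

sum-mono-≤ : {f g : Fin n → ℤ} → (∀ j → f j ≤ g j) → sum f ≤ sum g
sum-mono-≤ {zero}  f≤g = ℤₚ.≤-refl
sum-mono-≤ {suc n} f≤g = ℤₚ.+-mono-≤ (f≤g zero) (sum-mono-≤ (f≤g ∘ suc))

sum-nonneg : {f : Fin n → ℤ} → (∀ j → 0ℤ ≤ f j) → 0ℤ ≤ sum f
sum-nonneg {n} 0≤f = ℤₚ.≤-trans (ℤₚ.≤-reflexive (sym (sum-zero n))) (sum-mono-≤ 0≤f)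

sum-when : ∀ b (f : Fin n → ℤ) → sum (λ j → when b (f j)) ≡ when b (sum f)
sum-when true  f = refl
sum-when {n} false f = sum-zero n

sumWhere-cong : ∀ (P : Fin n → Bool) {f g} → (∀ j → T (P j) → f j ≡ g j) → sumWhere P f ≡ sumWhere P g
sumWhere-cong P f≡g = sum-cong-≗ (λ j → when-cong (P j) (f≡g j))
  where
  when-cong : ∀ b {x y} → (T b → x ≡ y) → when b x ≡ when b y
  when-cong true  x≡y = x≡y _
  when-cong false x≡y = refl

sumWhere-nonneg : ∀ (P : Fin n → Bool) {f} → (∀ j → 0ℤ ≤ f j) → 0ℤ ≤ sumWhere P f
sumWhere-nonneg P 0≤f = sum-nonneg (λ j → when-nonneg (P j) (0≤f j))
  where
  when-nonneg : ∀ b {x} → 0ℤ ≤ x → 0ℤ ≤ when b x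
  when-nonneg true  0≤x = 0≤x
  when-nonneg false 0≤x = ℤₚ.≤-refl

sumWhere≤sum : ∀ (P : Fin n → Bool) {f} → (∀ j → 0ℤ ≤ f j) → sumWhere P f ≤ sum f
sumWhere≤sum P 0≤f = sum-mono-≤ (λ j → when-≤ (P j) (0≤f j))
  where
  when-≤ : ∀ b {x} → 0ℤ ≤ x → when b x ≤ x
  when-≤ true  0≤x = ℤₚ.≤-refl
  when-≤ false 0≤x = 0≤x

sumWhere-comm : ∀ (P Q : Fin n → Bool) (A : Fin n → Fin n → ℤ) →
  sumWhere P (λ i → sumWhere Q (A i)) ≡ sumWhere Q (λ j → sumWhere P (λ i → A i j))
sumWhere-comm P Q A = begin
  sum (λ i → when (P i) (sum (λ j → when (Q j) (A i j))))  ≡⟨ sum-cong-≗ (λ i → sum-when (P i) (λ j → when (Q j) (A i j))) ⟨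
  sum (λ i → sum (λ j → when (P i) (when (Q j) (A i j))))  ≡⟨ ∑-comm (λ i j → when (P i) (when (Q j) (A i j))) ⟩
  sum (λ j → sum (λ i → when (P i) (when (Q j) (A i j))))  ≡⟨ sum-cong-≗ (λ j → sum-cong-≗ (λ i → when-comm (P i) (Q j))) ⟩
  sum (λ j → sum (λ i → when (Q j) (when (P i) (A i j))))  ≡⟨ sum-cong-≗ (λ j → sum-when (Q j) (λ i → when (P i) (A i j))) ⟩
  sum (λ j → when (Q j) (sum (λ i → when (P i) (A i j))))  ∎
  where
  open ≡-Reasoning
  when-comm : ∀ p q {x} → when p (when q x) ≡ when q (when p x)
  when-comm true  q     = refl
  when-comm false true  = refl
  when-comm false false = refl

private
  shift : ∀ x y z → x + (y + z) ≡ (x + y) + (0ℤ + z)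
  shift = solve-∀

  shift₀ : ∀ x {y} z → y ≡ 0ℤ → x + z ≡ (x + y) + (0ℤ + z)
  shift₀ x z refl = identity x z
    where
    identity : ∀ x z → x + z ≡ (x + 0ℤ) + (0ℤ + z)
    identity = solve-∀

sum<-zero : ∀ (f : Fin n → ℤ) → sum< 0 f ≡ 0ℤ
sum<-zero {n} f = sum-zero n

sum≡sum<+sum> : ∀ t (f : Fin n → ℤ) → sum f ≡ sum< (suc t) f + sum> t f
sum≡sum<+sum> {zero}  t       f = refl
sum≡sum<+sum> {suc n} zero    f = shift₀ (f zero) _ (sum<-zero (f ∘ suc))
sum≡sum<+sum> {suc n} (suc t) f =
  trans (cong (_+_ (f zero)) (sum≡sum<+sum> t (f ∘ suc))) (shift (f zero) _ _)

sum<-suc : ∀ (f : Fin n → ℤ) m → sum< (suc (toℕ m)) f ≡ sum< (toℕ m) f + f m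
sum<-suc f zero = swap (f zero) (sum< 0 (f ∘ suc))
  where
  swap : ∀ x z → x + z ≡ (0ℤ + z) + x
  swap = solve-∀
sum<-suc f (suc m) =
  trans (cong (_+_ (f zero)) (sum<-suc (f ∘ suc) m)) (sym (ℤₚ.+-assoc (f zero) _ _))

sum<-split : ∀ (f : Fin n → ℤ) {m v} → m ℕ.< v → sum< v f ≡ sum< (suc m) f + sumBetween m v f
sum<-split {zero}  f m<v = refl
sum<-split {suc n} f {zero} {suc v} m<v = shift₀ (f zero) _ (sum<-zero (f ∘ suc))
sum<-split {suc n} f {suc m} {suc v} (s≤s m<v) =
  trans (cong (_+_ (f zero)) (sum<-split (f ∘ suc) m<v)) (shift (f zero) (sum< (suc m) (f ∘ suc)) _)

sum<-splitAt : ∀ (f : Fin n → ℤ) m {v} → toℕ m ℕ.< v →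
               sum< v f ≡ (sum< (toℕ m) f + f m) + sumBetween (toℕ m) v f
sum<-splitAt f m {v} m<v = trans (sum<-split f m<v) (cong (_+ sumBetween (toℕ m) v f) (sum<-suc f m))

sum<-cong : ∀ v {f g : Fin n → ℤ} → (∀ j → toℕ j ℕ.< v → f j ≡ g j) → sum< v f ≡ sum< v g
sum<-cong v f≗g = sumWhere-cong _ (λ j j<v → f≗g j (ℕₚ.<ᵇ⇒< _ v j<v))

sumBetween-cong : ∀ u v {f g : Fin n → ℤ} → (∀ j → u ℕ.< toℕ j → toℕ j ℕ.< v → f j ≡ g j) →
                  sumBetween u v f ≡ sumBetween u v g
sumBetween-cong u v f≗g = sumWhere-cong _ (λ j u<j<v →
  let u<j , j<v = Equivalence.to T-∧ u<j<v in f≗g j (ℕₚ.<ᵇ⇒< u _ u<j) (ℕₚ.<ᵇ⇒< _ v j<v))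

sum<-< : {f : Fin n → ℤ} → (∀ j → 0ℤ ≤ f j) → ∀ x {v} → f x ≡ 1ℤ → toℕ x ℕ.< v →
         sum< (toℕ x) f < sum< v f
sum<-< {f = f} 0≤f x {v} fx≡1 x<v = begin-strict
  s                  ≡⟨ ℤₚ.+-identityʳ s ⟨
  s + 0ℤ             <⟨ ℤₚ.+-monoʳ-< s (ℤₚ.<-≤-trans (ℤ.+<+ (s≤s z≤n)) (ℤₚ.+-monoʳ-≤ 1ℤ 0≤B)) ⟩
  s + (1ℤ + B)       ≡⟨ ℤₚ.+-assoc s 1ℤ B ⟨
  (s + 1ℤ) + B       ≡⟨ cong (λ y → (s + y) + B) fx≡1 ⟨
  (s + f x) + B      ≡⟨ sum<-splitAt f x x<v ⟨
  sum< v f           ∎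
  where
  open ℤₚ.≤-Reasoning
  s B : ℤ
  s = sum< (toℕ x) f
  B = sumBetween (toℕ x) v f
  0≤B : 0ℤ ≤ B
  0≤B = sumWhere-nonneg _ 0≤f

sum<-injective : {f : Fin n → ℤ} → (∀ j → 0ℤ ≤ f j) → ∀ {x y} → f x ≡ 1ℤ → f y ≡ 1ℤ →
                 sum< (toℕ x) f ≡ sum< (toℕ y) f → x ≡ y
sum<-injective 0≤f {x} {y} fx≡1 fy≡1 eq with Finₚ.<-cmp x y
... | tri≈ _ x≡y _ = x≡y
... | tri< x<y _ _ = ⊥-elim (ℤₚ.<-irrefl eq (sum<-< 0≤f x fx≡1 x<y))
... | tri> _ _ y<x = ⊥-elim (ℤₚ.<-irrefl (sym eq) (sum<-< 0≤f y fy≡1 y<x))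

sumBetween-injective : {f : Fin n → ℤ} → (∀ j → 0ℤ ≤ f j) → ∀ {u x y} →
  u ℕ.< toℕ x → u ℕ.< toℕ y → f x ≡ 1ℤ → f y ≡ 1ℤ →
  sumBetween u (toℕ x) f ≡ sumBetween u (toℕ y) f → x ≡ y
sumBetween-injective {f = f} 0≤f {u} {x} {y} u<x u<y fx≡1 fy≡1 eq = sum<-injective 0≤f fx≡1 fy≡1 (begin
  sum< (toℕ x) f                               ≡⟨ sum<-split f u<x ⟩
  sum< (suc u) f + sumBetween u (toℕ x) f      ≡⟨ cong (_+_ (sum< (suc u) f)) eq ⟩
  sum< (suc u) f + sumBetween u (toℕ y) f      ≡⟨ sum<-split f u<y ⟨
  sum< (toℕ y) f                               ∎)
  where open ≡-Reasoning

sum>-ones : ∀ n t → sum> {n} t (λ _ → 1ℤ) ≡ + (n ∸ suc t)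
sum>-ones zero    t       = refl
sum>-ones (suc n) zero    = trans (ℤₚ.+-identityˡ _) (sum-ones n)
  where
  sum-ones : ∀ n → sum {n} (λ _ → 1ℤ) ≡ + n
  sum-ones zero    = refl
  sum-ones (suc n) = cong (_+_ 1ℤ) (sum-ones n)
sum>-ones (suc n) (suc t) = trans (ℤₚ.+-identityˡ _) (sum>-ones n t)

regionSum-byColumns : ∀ (A : Matrix n) (P Q : Fin n → Bool) →
  regionSum A (λ i j → P i ∧ Q j) ≡ sumWhere Q (λ j → sumWhere P (λ i → A i j))
regionSum-byColumns {n} A P Q = begin
  regionSum A (λ i j → P i ∧ Q j)
    ≡⟨ sumℤ-allFin (λ i → sumℤ (map (λ j → when (P i ∧ Q j) (A i j)) (allFin n))) ⟩
  sum (λ i → sumℤ (map (λ j → when (P i ∧ Q j) (A i j)) (allFin n)))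
    ≡⟨ sum-cong-≗ (λ i → trans (sumℤ-allFin (λ j → when (P i ∧ Q j) (A i j)))
                               (sum-cong-≗ (λ j → when-∧ (P i) (Q j)))) ⟩
  sum (λ i → sum (λ j → when (P i) (when (Q j) (A i j))))    ≡⟨ sum-cong-≗ (λ i → sum-when (P i) (λ j → when (Q j) (A i j))) ⟩
  sumWhere P (λ i → sumWhere Q (A i))                        ≡⟨ sumWhere-comm P Q A ⟩
  sumWhere Q (λ j → sumWhere P (λ i → A i j))                ∎
  where
  open ≡-Reasoning
  when-∧ : ∀ p q {x} → when (p ∧ q) x ≡ when p (when q x)
  when-∧ true  q = refl
  when-∧ false q = refl

private
  <ᵇ-toℕ : (i j : Fin n) → (i <ᵇ j) ≡ (toℕ i ℕ.<ᵇ toℕ j)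
  <ᵇ-toℕ i j = isYes≗does (i Finₚ.<? j)

  sumWhere-congᴾ : ∀ {P Q : Fin n → Bool} {f g} → (∀ j → P j ≡ Q j) → (∀ j → f j ≡ g j) →
                   sumWhere P f ≡ sumWhere Q g
  sumWhere-congᴾ P≗Q f≗g = sum-cong-≗ (λ j → cong₂ when (P≗Q j) (f≗g j))

belowLeft-byColumns : ∀ (A : Matrix n) R x →
  belowLeft A R x ≡ sum< (toℕ x) (λ j → sum> (toℕ R) (λ i → A i j))
belowLeft-byColumns A R x = trans (regionSum-byColumns A (R <ᵇ_) (_<ᵇ x))
  (sumWhere-congᴾ (λ j → <ᵇ-toℕ j x) (λ j → sumWhere-congᴾ (<ᵇ-toℕ R) (λ _ → refl)))

belowBetween-byColumns : ∀ (A : Matrix n) R u v →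
  regionSum A (λ i j → (R <ᵇ i) ∧ ((u <ᵇ j) ∧ (j <ᵇ v))) ≡
  sumBetween (toℕ u) (toℕ v) (λ j → sum> (toℕ R) (λ i → A i j))
belowBetween-byColumns A R u v = trans (regionSum-byColumns A (R <ᵇ_) (λ j → (u <ᵇ j) ∧ (j <ᵇ v)))
  (sumWhere-congᴾ (λ j → cong₂ _∧_ (<ᵇ-toℕ u j) (<ᵇ-toℕ j v))
                  (λ j → sumWhere-congᴾ (<ᵇ-toℕ R) (λ _ → refl)))

-- Alternating sequences

bitℕ : Bool → ℕ
bitℕ true  = 1
bitℕ false = 0

bit : Bool → ℤ
bit b = + bitℕ b

δ : Fin n → Fin n → ℤ
δ x j = bit (does (j Finₚ.≟ x))

δ⁺⁻⁺ : Fin n → Fin n → Fin n → Fin n → ℤ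
δ⁺⁻⁺ x c z j = δ x j + (δ z j - δ c j)

In01 : ℤ → Set
In01 z = z ≡ 0ℤ ⊎ z ≡ 1ℤ

In01[1+g]⇒g≡0 : ∀ {g} → In01 (1ℤ + g) → In01 g → g ≡ 0ℤ
In01[1+g]⇒g≡0 _         (inj₁ g≡0) = g≡0
In01[1+g]⇒g≡0 (inj₁ ()) (inj₂ refl)
In01[1+g]⇒g≡0 (inj₂ ()) (inj₂ refl)

In01[-1+g]⇒g≡1 : ∀ {g} → In01 (-1ℤ + g) → In01 g → g ≡ 1ℤ
In01[-1+g]⇒g≡1 (inj₁ ()) (inj₁ refl)
In01[-1+g]⇒g≡1 (inj₂ ()) (inj₁ refl)
In01[-1+g]⇒g≡1 _         (inj₂ g≡1) = g≡1

In01-nonneg : ∀ {g} → In01 g → 0ℤ ≤ g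
In01-nonneg (inj₁ refl) = ℤₚ.≤-refl
In01-nonneg (inj₂ refl) = ℤ.+≤+ z≤n

nz : (Fin n → ℤ) → List ℤ
nz f = nonzeros (tabulate f)

alternating-first : ∀ {x xs} → Alternating (x ∷ xs) → x ≡ 1ℤ × Alternating (1ℤ ∷ xs)
alternating-first single    = refl , single
alternating-first (step al) = refl , step al

alternating-second : ∀ {x xs} → Alternating (1ℤ ∷ x ∷ xs) → x ≡ -1ℤ × Alternating xs
alternating-second (step al) = refl , al

nz-cong : {f g : Fin n → ℤ} → (∀ j → f j ≡ g j) → nz f ≡ nz g
nz-cong f≗g = cong nonzeros (Listₚ.tabulate-cong f≗g)

SuffixSums01 : (Fin n → ℤ) → Set
SuffixSums01 f = ∀ t → In01 (sum> t f)

private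
  sums-cons : ∀ (f : Fin (suc n) → ℤ) {v s} → f zero ≡ v →
              sum (f ∘ suc) ≡ s × SuffixSums01 (f ∘ suc) → In01 s → sum f ≡ v + s × SuffixSums01 f
  sums-cons f f₀≡v (sum≡s , suffix) s01 = cong₂ _+_ f₀≡v sum≡s , λ where
    zero    → subst In01 (sym (trans (ℤₚ.+-identityˡ _) sum≡s)) s01
    (suc t) → subst In01 (sym (ℤₚ.+-identityˡ _)) (suffix t)

alternating-sums : (f : Fin n → ℤ) →
  (Alternating (nz f) → sum f ≡ 1ℤ × SuffixSums01 f) ×
  (Alternating (1ℤ ∷ nz f) → sum f ≡ 0ℤ × SuffixSums01 f)
alternating-sums {zero}  f = (λ ()) , λ _ → refl , λ _ → inj₁ refl
alternating-sums {suc n} f with alternating-sums (f ∘ suc) | f zero ℤₚ.≟ 0ℤ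
... | onAlt , onAlt1 | yes f₀≡0 =
      (λ al → sums-cons f f₀≡0 (onAlt al) (inj₂ refl))
    , (λ al → sums-cons f f₀≡0 (onAlt1 al) (inj₁ refl))
... | onAlt , onAlt1 | no _ =
      (λ al → sums-cons f (proj₁ (alternating-first al)) (onAlt1 (proj₂ (alternating-first al))) (inj₁ refl))
    , (λ al → sums-cons f (proj₁ (alternating-second al)) (onAlt (proj₂ (alternating-second al))) (inj₂ refl))

alternating-tail⇒zero : {f : Fin n → ℤ} → Alternating (1ℤ ∷ nz f) → (∀ j → f j ≢ -1ℤ) → ∀ j → f j ≡ 0ℤ
alternating-tail⇒zero {suc n} {f} al no-1 j with f zero ℤₚ.≟ 0ℤ
alternating-tail⇒zero {suc n} {f} al no-1 j       | no _ = ⊥-elim (no-1 zero (proj₁ (alternating-second al)))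
alternating-tail⇒zero {suc n} {f} al no-1 zero    | yes f₀≡0 = f₀≡0
alternating-tail⇒zero {suc n} {f} al no-1 (suc j) | yes _ = alternating-tail⇒zero al (no-1 ∘ suc) j

alternating⇒δ : {f : Fin n → ℤ} → Alternating (nz f) → (∀ j → f j ≢ -1ℤ) → ∃ λ x → ∀ j → f j ≡ δ x j
alternating⇒δ {suc n} {f} al no-1 with f zero ℤₚ.≟ 0ℤ
... | yes f₀≡0 = let x , f≗δx = alternating⇒δ al (no-1 ∘ suc) in
  suc x , λ where
    zero    → f₀≡0
    (suc j) → f≗δx j
... | no _ = let f₀≡1 , al′ = alternating-first al in
  zero , λ where
    zero    → f₀≡1
    (suc j) → alternating-tail⇒zero al′ (no-1 ∘ suc) j

alternating-tail⇒δ-δ : {f : Fin n → ℤ} {c : Fin n} → Alternating (1ℤ ∷ nz f) → f c ≡ -1ℤ → (∀ j → f j ≡ -1ℤ → j ≡ c) →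
           ∃ λ z → c Fin.< z × ∀ j → f j ≡ δ z j - δ c j
alternating-tail⇒δ-δ {suc n} {f} {c} al fc≡-1 only-c with f zero ℤₚ.≟ 0ℤ
alternating-tail⇒δ-δ {suc n} {f} {zero}  al fc≡-1 only-c | yes f₀≡0 with () ← trans (sym fc≡-1) f₀≡0
alternating-tail⇒δ-δ {suc n} {f} {suc c} al fc≡-1 only-c | yes f₀≡0 =
  let z , c<z , f≗ = alternating-tail⇒δ-δ al fc≡-1 (λ j fj≡-1 → Finₚ.suc-injective (only-c (suc j) fj≡-1)) in
  suc z , s≤s c<z , λ where
    zero    → f₀≡0
    (suc j) → f≗ j
alternating-tail⇒δ-δ {suc n} {f} {c} al fc≡-1 only-c | no _ with alternating-second al
... | f₀≡-1 , al′ with only-c zero f₀≡-1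
... | refl = let x , f≗δx = alternating⇒δ al′ (λ j fj≡-1 → suc≢0 (only-c (suc j) fj≡-1)) in
  suc x , s≤s z≤n , λ where
    zero    → f₀≡-1
    (suc j) → trans (f≗δx j) (sym (ℤₚ.+-identityʳ _))
  where
  suc≢0 : ∀ {j : Fin n} → Fin.suc j ≢ zero
  suc≢0 ()

alternating⇒δ⁺⁻⁺ : {f : Fin n → ℤ} {c : Fin n} → Alternating (nz f) → f c ≡ -1ℤ → (∀ j → f j ≡ -1ℤ → j ≡ c) →
              ∃₂ λ x z → x Fin.< c × c Fin.< z × ∀ j → f j ≡ δ⁺⁻⁺ x c z j
alternating⇒δ⁺⁻⁺ {suc n} {f} {c} al fc≡-1 only-c with f zero ℤₚ.≟ 0ℤ
alternating⇒δ⁺⁻⁺ {suc n} {f} {zero}  al fc≡-1 only-c | yes f₀≡0 with () ← trans (sym fc≡-1) f₀≡0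
alternating⇒δ⁺⁻⁺ {suc n} {f} {suc c} al fc≡-1 only-c | yes f₀≡0 =
  let x , z , x<c , c<z , f≗ = alternating⇒δ⁺⁻⁺ al fc≡-1 (λ j fj≡-1 → Finₚ.suc-injective (only-c (suc j) fj≡-1)) in
  suc x , suc z , s≤s x<c , s≤s c<z , λ where
    zero    → f₀≡0
    (suc j) → f≗ j
alternating⇒δ⁺⁻⁺ {suc n} {f} {c} al fc≡-1 only-c | no _ with alternating-first al
alternating⇒δ⁺⁻⁺ {suc n} {f} {zero}  al fc≡-1 only-c | no _ | f₀≡1 , _ with () ← trans (sym fc≡-1) f₀≡1
alternating⇒δ⁺⁻⁺ {suc n} {f} {suc c} al fc≡-1 only-c | no _ | f₀≡1 , al′ =
  let z , c<z , f≗ = alternating-tail⇒δ-δ al′ fc≡-1 (λ j fj≡-1 → Finₚ.suc-injective (only-c (suc j) fj≡-1)) in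
  zero , suc z , s≤s z≤n , s≤s c<z , λ where
    zero    → f₀≡1
    (suc j) → trans (f≗ j) (sym (ℤₚ.+-identityˡ _))

nz-zeros : ∀ n → nz {n} (λ _ → 0ℤ) ≡ []
nz-zeros zero    = refl
nz-zeros (suc n) = nz-zeros n

δ-alternating : ∀ (x : Fin n) → Alternating (nz (δ x))
δ-alternating {suc n} zero    = subst (Alternating ∘ (1ℤ ∷_)) (sym (nz-zeros n)) single
δ-alternating         (suc x) = δ-alternating x

δ-δ-alternating : ∀ {c z : Fin n} → c Fin.< z → Alternating (1ℤ ∷ nz (λ j → δ z j - δ c j))
δ-δ-alternating {suc n} {zero}  {suc z} _ =
  step (subst Alternating (nz-cong (λ j → sym (ℤₚ.+-identityʳ (δ z j)))) (δ-alternating z))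
δ-δ-alternating {suc n} {suc c} {suc z} (s≤s c<z) = δ-δ-alternating c<z

δ⁺⁻⁺-alternating : ∀ {x c z : Fin n} → x Fin.< c → c Fin.< z → Alternating (nz (δ⁺⁻⁺ x c z))
δ⁺⁻⁺-alternating {suc n} {zero}  {suc c} {suc z} _ (s≤s c<z) =
  subst (Alternating ∘ (1ℤ ∷_)) (nz-cong (λ j → sym (ℤₚ.+-identityˡ (δ z j - δ c j)))) (δ-δ-alternating c<z)
δ⁺⁻⁺-alternating {suc n} {suc x} {suc c} {suc z} (s≤s x<c) (s≤s c<z) = δ⁺⁻⁺-alternating x<c c<z

steps : (ℕ → Bool) → Fin n → ℤ
steps g i = bit (g (toℕ i)) - bit (g (suc (toℕ i)))

steps-alternating : ∀ n (g : ℕ → Bool) → g n ≡ false →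
  (g 0 ≡ true → Alternating (nz (steps {n} g))) × (g 0 ≡ false → Alternating (1ℤ ∷ nz (steps {n} g)))
steps-alternating zero    g g₀≡false rewrite g₀≡false = (λ ()) , λ _ → single
steps-alternating (suc n) g gₙ≡false with steps-alternating n (g ∘ suc) gₙ≡false
... | fromTrue , fromFalse with g 0 | g 1
... | true  | true  = (λ _ → fromTrue refl) , λ ()
... | true  | false = (λ _ → fromFalse refl) , λ ()
... | false | true  = (λ ()) , λ _ → step (fromTrue refl)
... | false | false = (λ ()) , λ _ → fromFalse refl

sum-steps : ∀ (g : ℕ → Bool) → sum {n} (steps g) ≡ bit (g 0) - bit (g n)
sum-steps {zero}  g = sym (ℤₚ.+-inverseʳ (bit (g 0)))
sum-steps {suc n} g = trans (cong (_+_ (steps {suc n} g zero)) (sum-steps {n} (g ∘ suc))) (telescope (bit (g 0)) (bit (g 1)) (bit (g (suc n))))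
  where
  telescope : ∀ x y z → (x - y) + (y - z) ≡ x - z
  telescope = solve-∀

sum>-steps : ∀ (g : ℕ → Bool) t → t ℕ.< n → sum> {n} t (steps g) ≡ bit (g (suc t)) - bit (g n)
sum>-steps {suc n} g zero    _         = trans (ℤₚ.+-identityˡ _) (sum-steps (g ∘ suc))
sum>-steps {suc n} g (suc t) (s≤s t<n) = trans (ℤₚ.+-identityˡ _) (sum>-steps (g ∘ suc) t t<n)

-- Unit rows and closing rows

δ-self : ∀ (x : Fin n) → δ x x ≡ 1ℤ
δ-self x = cong bit (dec-true (x Finₚ.≟ x) refl)

δ-other : ∀ {x j : Fin n} → j ≢ x → δ x j ≡ 0ℤ
δ-other {x = x} {j} j≢x = cong bit (dec-false (j Finₚ.≟ x) j≢x)

δ≡1 : ∀ {x j : Fin n} → δ x j ≡ 1ℤ → j ≡ x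
δ≡1 {x = x} {j} δxj≡1 with j Finₚ.≟ x
... | yes j≡x = j≡x
... | no  _   with () ← δxj≡1

δ-fromℕ< : ∀ {m} (m<n : m ℕ.< n) j → bit (does (toℕ j ℕₚ.≟ m)) ≡ δ (fromℕ< m<n) j
δ-fromℕ< {m = m} m<n j with j Finₚ.≟ fromℕ< m<n
... | yes refl = cong bit (dec-true (toℕ j ℕₚ.≟ m) (Finₚ.toℕ-fromℕ< m<n))
... | no  j≢x  = cong bit (dec-false (toℕ j ℕₚ.≟ m) (λ j≡m → j≢x (Finₚ.toℕ-injective (trans j≡m (sym (Finₚ.toℕ-fromℕ< m<n))))))

δ⁺⁻⁺-values : ∀ (x c z j : Fin n) {u v w} → δ x j ≡ u → δ c j ≡ v → δ z j ≡ w → δ⁺⁻⁺ x c z j ≡ u + (w - v)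
δ⁺⁻⁺-values x c z j refl refl refl = refl

module _ {x c z : Fin n} (x<c : x Fin.< c) (c<z : c Fin.< z) where

  private
    x<z : x Fin.< z
    x<z = Finₚ.<-trans x<c c<z

  δ⁺⁻⁺-x : δ⁺⁻⁺ x c z x ≡ 1ℤ
  δ⁺⁻⁺-x = δ⁺⁻⁺-values x c z x (δ-self x) (δ-other (Finₚ.<⇒≢ x<c)) (δ-other (Finₚ.<⇒≢ x<z))

  δ⁺⁻⁺-c : δ⁺⁻⁺ x c z c ≡ -1ℤ
  δ⁺⁻⁺-c = δ⁺⁻⁺-values x c z c (δ-other (≢-sym (Finₚ.<⇒≢ x<c))) (δ-self c) (δ-other (Finₚ.<⇒≢ c<z))

  δ⁺⁻⁺-z : δ⁺⁻⁺ x c z z ≡ 1ℤ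
  δ⁺⁻⁺-z = δ⁺⁻⁺-values x c z z (δ-other (≢-sym (Finₚ.<⇒≢ x<z))) (δ-other (≢-sym (Finₚ.<⇒≢ c<z))) (δ-self z)

  δ⁺⁻⁺-elsewhere : ∀ {j} → j ≢ x → j ≢ c → j ≢ z → δ⁺⁻⁺ x c z j ≡ 0ℤ
  δ⁺⁻⁺-elsewhere {j} j≢x j≢c j≢z = δ⁺⁻⁺-values x c z j (δ-other j≢x) (δ-other j≢c) (δ-other j≢z)

  δ⁺⁻⁺-left : ∀ {j} → j Fin.< x → δ⁺⁻⁺ x c z j ≡ 0ℤ
  δ⁺⁻⁺-left j<x = δ⁺⁻⁺-elsewhere (Finₚ.<⇒≢ j<x) (Finₚ.<⇒≢ (Finₚ.<-trans j<x x<c)) (Finₚ.<⇒≢ (Finₚ.<-trans j<x x<z))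

  δ⁺⁻⁺-between-x-c : ∀ {j} → x Fin.< j → j Fin.< c → δ⁺⁻⁺ x c z j ≡ 0ℤ
  δ⁺⁻⁺-between-x-c x<j j<c = δ⁺⁻⁺-elsewhere (≢-sym (Finₚ.<⇒≢ x<j)) (Finₚ.<⇒≢ j<c) (Finₚ.<⇒≢ (Finₚ.<-trans j<c c<z))

  δ⁺⁻⁺-between-c-z : ∀ {j} → c Fin.< j → j Fin.< z → δ⁺⁻⁺ x c z j ≡ 0ℤ
  δ⁺⁻⁺-between-c-z c<j j<z = δ⁺⁻⁺-elsewhere (≢-sym (Finₚ.<⇒≢ (Finₚ.<-trans x<c c<j))) (≢-sym (Finₚ.<⇒≢ c<j)) (Finₚ.<⇒≢ j<z)

  δ⁺⁻⁺≡1 : ∀ j → δ⁺⁻⁺ x c z j ≡ 1ℤ → j ≡ x ⊎ j ≡ z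
  δ⁺⁻⁺≡1 j with j Finₚ.≟ x | j Finₚ.≟ z | j Finₚ.≟ c
  ... | yes j≡x | _       | _     = λ _ → inj₁ j≡x
  ... | no _    | yes j≡z | _     = λ _ → inj₂ j≡z
  ... | no _    | no _    | yes _ = λ ()
  ... | no _    | no _    | no _  = λ ()

  δ⁺⁻⁺≡-1 : ∀ j → δ⁺⁻⁺ x c z j ≡ -1ℤ → j ≡ c
  δ⁺⁻⁺≡-1 j with j Finₚ.≟ c | j Finₚ.≟ x | j Finₚ.≟ z
  ... | yes j≡c | _     | _     = λ _ → j≡c
  ... | no _    | yes _ | yes _ = λ ()
  ... | no _    | yes _ | no _  = λ ()
  ... | no _    | no _  | yes _ = λ ()
  ... | no _    | no _  | no _  = λ ()

leftmost-unique : ∀ (A : Matrix n) R {x y} → LeftmostOneAt A R x → LeftmostOneAt A R y → x ≡ y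
leftmost-unique A R {x} {y} (Ax≡1 , left-of-x) (Ay≡1 , left-of-y) with Finₚ.<-cmp x y
... | tri< x<y _ _ = ⊥-elim (left-of-y x x<y Ax≡1)
... | tri≈ _ x≡y _ = x≡y
... | tri> _ _ y<x = ⊥-elim (left-of-x y y<x Ay≡1)

leftmost-if-zeros : ∀ (A : Matrix n) R {x} → A R x ≡ 1ℤ → (∀ j → j Fin.< x → A R j ≡ 0ℤ) → LeftmostOneAt A R x
leftmost-if-zeros A R Ax≡1 zeros = Ax≡1 , λ j j<x Aj≡1 → 0≢1 (trans (sym (zeros j j<x)) Aj≡1)
  where
  0≢1 : 0ℤ ≢ 1ℤ
  0≢1 ()

-- Elements of 𝒩_{n,1} with a given generalized inversion table

table-arithmetic : ∀ {aᵢ aⱼ b β m : ℕ} {ℓ : ℤ} → 0ℤ ≤ ℓ → + aⱼ ≡ + aᵢ + (1ℤ + ℓ) → + β ≤ + b + ℓ →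
  + aⱼ + + b ≤ + m → aᵢ ℕ.< aⱼ × (aᵢ ℕ.+ β ℕ.< aⱼ ℕ.+ b × aⱼ ℕ.+ b ℕ.≤ m)
table-arithmetic {aᵢ} {aⱼ} {b} {β} {ℓ = + L} _ aⱼ≡ β≤ aⱼ+b≤ =
  subst (aᵢ ℕ.<_) (sym aⱼ≡aᵢ+1+L) (ℕₚ.m<m+n aᵢ (s≤s z≤n)) , aᵢ+β<aⱼ+b , ℤₚ.drop‿+≤+ aⱼ+b≤
  where
  aⱼ≡aᵢ+1+L : aⱼ ≡ aᵢ ℕ.+ suc L
  aⱼ≡aᵢ+1+L = ℤₚ.+-injective aⱼ≡
  aᵢ+β<aⱼ+b : aᵢ ℕ.+ β ℕ.< aⱼ ℕ.+ b
  aᵢ+β<aⱼ+b = begin-strict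
    aᵢ ℕ.+ β              ≤⟨ ℕₚ.+-monoʳ-≤ aᵢ (ℤₚ.drop‿+≤+ β≤) ⟩
    aᵢ ℕ.+ (b ℕ.+ L)      <⟨ ℕₚ.+-monoʳ-< aᵢ (ℕₚ.n<1+n _) ⟩
    aᵢ ℕ.+ suc (b ℕ.+ L)  ≡⟨ cong (aᵢ ℕ.+_) (cong suc (ℕₚ.+-comm b L)) ⟩
    aᵢ ℕ.+ (suc L ℕ.+ b)  ≡⟨ ℕₚ.+-assoc aᵢ (suc L) b ⟨
    aᵢ ℕ.+ suc L ℕ.+ b    ≡⟨ cong (ℕ._+ b) aⱼ≡aᵢ+1+L ⟨
    aⱼ ℕ.+ b              ∎
    where open ℕₚ.≤-Reasoning

module Analysis {n k : ℕ} {N : Matrix n} {E : ℤ} {a : Fin n → ℕ} {b β : ℕ} (H : HasGIT N E k a b β) where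

  open HasGIT H public

  col : Fin n → Fin n → ℤ
  col j i = N i j

  rowAlternating : ∀ i → Alternating (nz (N i))
  rowAlternating i = subst (Alternating ∘ nonzeros) (Listₚ.map-tabulate id (N i)) (proj₁ (proj₂ asm) i)

  colAlternating : ∀ j → Alternating (nz (col j))
  colAlternating j = subst (Alternating ∘ nonzeros) (Listₚ.map-tabulate id (col j)) (proj₂ (proj₂ asm) j)

  rowSum : ∀ i → sum (N i) ≡ 1ℤ
  rowSum i = proj₁ (proj₁ (alternating-sums (N i)) (rowAlternating i))

  colSum : ∀ j → sum (col j) ≡ 1ℤ
  colSum j = proj₁ (proj₁ (alternating-sums (col j)) (colAlternating j))

  below : Fin n → Fin n → ℤ
  below R j = sum> (toℕ R) (col j)

  below-01 : ∀ R j → In01 (below R j)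
  below-01 R j = proj₂ (proj₁ (alternating-sums (col j)) (colAlternating j)) (toℕ R)

  below-nonneg : ∀ R j → 0ℤ ≤ below R j
  below-nonneg R j = In01-nonneg (below-01 R j)

  sum-below : ∀ R → sum (below R) ≡ + (n ∸ suc (toℕ R))
  sum-below R = begin
    sum (below R)                    ≡⟨ sumWhere-comm (λ i → toℕ R ℕ.<ᵇ toℕ i) (λ _ → true) N ⟨
    sum> (toℕ R) (λ i → sum (N i))   ≡⟨ sumWhere-cong _ (λ i _ → rowSum i) ⟩
    sum> {n} (toℕ R) (λ _ → 1ℤ)      ≡⟨ sum>-ones n (toℕ R) ⟩
    + (n ∸ suc (toℕ R))              ∎
    where open ≡-Reasoning

  belowLeft≡ : ∀ R x → belowLeft N R x ≡ sum< (toℕ x) (below R)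
  belowLeft≡ = belowLeft-byColumns N

  below≡ : ∀ t j → sum> t (col j) ≡ 1ℤ - sum< (suc t) (col j)
  below≡ t j = begin
    sum> t (col j)                                              ≡⟨ cancel (sum< (suc t) (col j)) (sum> t (col j)) ⟩
    (sum< (suc t) (col j) + sum> t (col j)) - sum< (suc t) (col j) ≡⟨ cong (_- sum< (suc t) (col j)) (sum≡sum<+sum> t (col j)) ⟨
    sum (col j) - sum< (suc t) (col j)                          ≡⟨ cong (_- sum< (suc t) (col j)) (colSum j) ⟩
    1ℤ - sum< (suc t) (col j)                                   ∎
    where
    open ≡-Reasoning
    cancel : ∀ p s → s ≡ (p + s) - p
    cancel = solve-∀

  from : Fin n → Fin n → ℤ
  from R j = N R j + below R j

  from≡ : ∀ R j → from R j ≡ 1ℤ - sum< (toℕ R) (col j)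
  from≡ R j = begin
    N R j + below R j                                   ≡⟨ cong (_+_ (N R j)) (below≡ (toℕ R) j) ⟩
    N R j + (1ℤ - sum< (suc (toℕ R)) (col j))           ≡⟨ cong (λ s → N R j + (1ℤ - s)) (sum<-suc (col j) R) ⟩
    N R j + (1ℤ - (sum< (toℕ R) (col j) + N R j))       ≡⟨ cancel (N R j) (sum< (toℕ R) (col j)) ⟩
    1ℤ - sum< (toℕ R) (col j)                           ∎
    where
    open ≡-Reasoning
    cancel : ∀ x s → x + (1ℤ - (s + x)) ≡ 1ℤ - s
    cancel = solve-∀

  from-01 : ∀ R j → In01 (from R j)
  from-01 R j with toℕ R | from≡ R j
  ... | zero  | from≡1-0 = inj₂ (trans from≡1-0 (cong (_-_ 1ℤ) (sum<-zero (col j))))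
  ... | suc t | from≡1-s =
    subst In01 (trans (below≡ t j) (sym from≡1-s)) (proj₂ (proj₁ (alternating-sums (col j)) (colAlternating j)) t)

  from-nonneg : ∀ R j → 0ℤ ≤ from R j
  from-nonneg R j = In01-nonneg (from-01 R j)

  from-one : ∀ R x → N R x ≡ 1ℤ → from R x ≡ 1ℤ
  from-one R x NRx≡1 = trans (cong (_+ below R x) NRx≡1) (cong (_+_ 1ℤ) below≡0)
    where
    below≡0 : below R x ≡ 0ℤ
    below≡0 = In01[1+g]⇒g≡0 (subst In01 (cong (_+ below R x) NRx≡1) (from-01 R x)) (below-01 R x)

  below-step : ∀ R R′ → toℕ R′ ≡ suc (toℕ R) → ∀ j → below R j ≡ from R′ j
  below-step R R′ R′≡1+R j = begin
    below R j                          ≡⟨ below≡ (toℕ R) j ⟩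
    1ℤ - sum< (suc (toℕ R)) (col j)    ≡⟨ cong (λ t → 1ℤ - sum< t (col j)) R′≡1+R ⟨
    1ℤ - sum< (toℕ R′) (col j)         ≡⟨ from≡ R′ j ⟨
    from R′ j                          ∎
    where open ≡-Reasoning

  o<r : o Fin.< r
  o<r = ℕₚ.≤-reflexive (sym neutral)

  unitRow : ∀ R → R ≢ r → ∃ λ x → ∀ j → N R j ≡ δ x j
  unitRow R R≢r = alternating⇒δ (rowAlternating R) (λ j NRj≡-1 → R≢r (proj₁ (proj₂ oneNeg R j NRj≡-1)))

  closingRow : ∃₂ λ x z → x Fin.< c × c Fin.< z × ∀ j → N r j ≡ δ⁺⁻⁺ x c z j
  closingRow = alternating⇒δ⁺⁻⁺ (rowAlternating r) (proj₁ oneNeg) (λ j Nrj≡-1 → proj₂ (proj₂ oneNeg r j Nrj≡-1))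

  x₁ z₁ : Fin n
  x₁ = proj₁ closingRow
  z₁ = proj₁ (proj₂ closingRow)

  x₁<c : x₁ Fin.< c
  x₁<c = proj₁ (proj₂ (proj₂ closingRow))

  c<z₁ : c Fin.< z₁
  c<z₁ = proj₁ (proj₂ (proj₂ (proj₂ closingRow)))

  closingRow≗ : ∀ j → N r j ≡ δ⁺⁻⁺ x₁ c z₁ j
  closingRow≗ = proj₂ (proj₂ (proj₂ (proj₂ closingRow)))

  openingRow≗ : ∀ j → N o j ≡ δ c j
  openingRow≗ with unitRow o (Finₚ.<⇒≢ o<r)
  ... | y , N≗δy with δ≡1 {x = y} {j = c} (trans (sym (N≗δy c)) (proj₁ opening))
  ... | refl = N≗δy

  p≡r : p ≡ r
  p≡r with Finₚ.<-cmp p r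
  ... | tri≈ _ p≡r _ = p≡r
  ... | tri< p<r _ _ = ⊥-elim (ℕₚ.<⇒≱ (proj₁ leading) (ℕₚ.≤-pred (subst (toℕ p ℕ.<_) neutral p<r)))
  ... | tri> _ _ r<p =
    ⊥-elim (proj₂ (proj₂ (proj₂ leading)) r x₁ o<r r<p x₁<c (trans (closingRow≗ x₁) (δ⁺⁻⁺-x x₁<c c<z₁)))

  q≡x₁ : q ≡ x₁
  q≡x₁ with δ⁺⁻⁺≡1 x₁<c c<z₁ q (trans (sym (closingRow≗ q)) (subst (λ R → N R q ≡ 1ℤ) p≡r (proj₁ (proj₂ (proj₂ leading)))))
  ... | inj₁ q≡x₁ = q≡x₁
  ... | inj₂ q≡z₁ = ⊥-elim (Finₚ.<-asym (proj₁ (proj₂ leading)) (subst (c Fin.<_) (sym q≡z₁) c<z₁))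

  cc≡z₁ : cc ≡ z₁
  cc≡z₁ with δ⁺⁻⁺≡1 x₁<c c<z₁ cc (trans (sym (closingRow≗ cc)) (proj₂ closing))
  ... | inj₂ cc≡z₁ = cc≡z₁
  ... | inj₁ cc≡x₁ = ⊥-elim (Finₚ.<-asym x₁<c (subst (c Fin.<_) cc≡x₁ (proj₁ closing)))

  Nr-x₁ : N r x₁ ≡ 1ℤ
  Nr-x₁ = trans (closingRow≗ x₁) (δ⁺⁻⁺-x x₁<c c<z₁)

  Nr-left : ∀ j → j Fin.< x₁ → N r j ≡ 0ℤ
  Nr-left j j<x₁ = trans (closingRow≗ j) (δ⁺⁻⁺-left x₁<c c<z₁ j<x₁)

  a-leftmost : ∀ R x → LeftmostOneAt N R x → + a (opposite R) ≡ sum< (toℕ x) (below R)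
  a-leftmost R x leftmost-x
    with subst (λ R′ → Σ (Fin n) λ y → LeftmostOneAt N R′ y × (+ a (opposite R) ≡ belowLeft N R′ y))
               (Finₚ.opposite-involutive R) (a-val (opposite R))
  ... | y , leftmost-y , a≡ = trans a≡ (trans (cong (belowLeft N R) (leftmost-unique N R leftmost-y leftmost-x)) (belowLeft≡ R x))

  a-closing : + a (opposite r) ≡ sum< (toℕ x₁) (below r)
  a-closing = a-leftmost r x₁ (leftmost-if-zeros N r Nr-x₁ Nr-left)

  below-opening : ∀ j → below o j ≡ N r j + below r j
  below-opening = below-step o r neutral

  below-r-x₁ : below r x₁ ≡ 0ℤ
  below-r-x₁ = In01[1+g]⇒g≡0 (subst In01 (trans (below-opening x₁) (cong (_+ below r x₁) Nr-x₁)) (below-01 o x₁)) (below-01 r x₁)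

  below-r-c : below r c ≡ 1ℤ
  below-r-c = In01[-1+g]⇒g≡1 (subst In01 (trans (below-opening c) (cong (_+ below r c) Nr-c)) (below-01 o c)) (below-01 r c)
    where
    Nr-c : N r c ≡ -1ℤ
    Nr-c = trans (closingRow≗ c) (δ⁺⁻⁺-c x₁<c c<z₁)

  ℓ : ℤ
  ℓ = ellVal N o c q

  ℓ≡ : ℓ ≡ sumBetween (toℕ x₁) (toℕ c) (below o)
  ℓ≡ = trans (belowBetween-byColumns N o q c) (cong (λ t → sumBetween (toℕ t) (toℕ c) (below o)) q≡x₁)

  ℓ-nonneg : 0ℤ ≤ ℓ
  ℓ-nonneg = subst (0ℤ ≤_) (sym ℓ≡) (sumWhere-nonneg _ (below-nonneg o))

  a-opening : + a (opposite o) ≡ + a (opposite r) + (1ℤ + ℓ)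
  a-opening = begin
    + a (opposite o)
      ≡⟨ a-leftmost o c (leftmost-if-zeros N o (proj₁ opening) (λ j j<c → trans (openingRow≗ j) (δ-other (Finₚ.<⇒≢ j<c)))) ⟩
    sum< (toℕ c) (below o)
      ≡⟨ sum<-splitAt (below o) x₁ x₁<c ⟩
    (sum< (toℕ x₁) (below o) + below o x₁) + sumBetween (toℕ x₁) (toℕ c) (below o)
      ≡⟨ cong₂ (λ s t → (s + t) + sumBetween (toℕ x₁) (toℕ c) (below o)) below-left below-x₁ ⟩
    (sum< (toℕ x₁) (below r) + 1ℤ) + sumBetween (toℕ x₁) (toℕ c) (below o)
      ≡⟨ cong₂ (λ s t → (s + 1ℤ) + t) a-closing ℓ≡ ⟨
    (+ a (opposite r) + 1ℤ) + ℓ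
      ≡⟨ ℤₚ.+-assoc (+ a (opposite r)) 1ℤ ℓ ⟩
    + a (opposite r) + (1ℤ + ℓ) ∎
    where
    open ≡-Reasoning
    below-left : sum< (toℕ x₁) (below o) ≡ sum< (toℕ x₁) (below r)
    below-left = sum<-cong (toℕ x₁) (λ j j<x₁ →
      trans (below-opening j) (trans (cong (_+ below r j) (Nr-left j j<x₁)) (ℤₚ.+-identityˡ _)))
    below-x₁ : below o x₁ ≡ 1ℤ
    below-x₁ = trans (below-opening x₁) (cong₂ _+_ Nr-x₁ below-r-x₁)

  ℓ≡sumBetween-below-r : ℓ ≡ sumBetween (toℕ x₁) (toℕ c) (below r)
  ℓ≡sumBetween-below-r = trans ℓ≡ (sumBetween-cong _ _ (λ j x₁<j j<c →
    trans (below-opening j) (trans (cong (_+ below r j) (Nr-between j x₁<j j<c)) (ℤₚ.+-identityˡ _))))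
    where
    Nr-between : ∀ j → x₁ Fin.< j → j Fin.< c → N r j ≡ 0ℤ
    Nr-between j x₁<j j<c = trans (closingRow≗ j) (δ⁺⁻⁺-between-x-c x₁<c c<z₁ x₁<j j<c)

  b≡ : + b ≡ sumBetween (toℕ c) (toℕ z₁) (below r)
  b≡ = trans b-val (trans (belowBetween-byColumns N r c cc) (cong (λ t → sumBetween (toℕ c) (toℕ t) (below r)) cc≡z₁))

  sum<-z₁ : sum< (toℕ z₁) (below r) ≡ + a (opposite o) + + b
  sum<-z₁ = begin
    sum< (toℕ z₁) (below r)
      ≡⟨ sum<-splitAt (below r) c c<z₁ ⟩
    (sum< (toℕ c) (below r) + below r c) + sumBetween (toℕ c) (toℕ z₁) (below r)
      ≡⟨ cong₂ (λ s t → (s + t) + sumBetween (toℕ c) (toℕ z₁) (below r)) (sum<-splitAt (below r) x₁ x₁<c) below-r-c ⟩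
    ((sum< (toℕ x₁) (below r) + below r x₁) + sumBetween (toℕ x₁) (toℕ c) (below r) + 1ℤ) + sumBetween (toℕ c) (toℕ z₁) (below r)
      ≡⟨ cong₂ (λ s t → ((s + below r x₁) + t + 1ℤ) + sumBetween (toℕ c) (toℕ z₁) (below r)) a-closing ℓ≡sumBetween-below-r ⟨
    ((+ a (opposite r) + below r x₁) + ℓ + 1ℤ) + sumBetween (toℕ c) (toℕ z₁) (below r)
      ≡⟨ cong₂ (λ s t → ((+ a (opposite r) + s) + ℓ + 1ℤ) + t) below-r-x₁ (sym b≡) ⟩
    ((+ a (opposite r) + 0ℤ) + ℓ + 1ℤ) + + b
      ≡⟨ cong (_+ + b) (rearrange (+ a (opposite r)) ℓ) ⟩
    (+ a (opposite r) + (1ℤ + ℓ)) + + b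
      ≡⟨ cong (_+ + b) a-opening ⟨
    + a (opposite o) + + b ∎
    where
    open ≡-Reasoning
    rearrange : ∀ x l → (x + 0ℤ) + l + 1ℤ ≡ x + (1ℤ + l)
    rearrange = solve-∀

  rows-below-r : n ∸ suc (toℕ r) ≡ k ∸ 2
  rows-below-r = begin
    n ∸ suc (toℕ r)                    ≡⟨ cong₂ _∸_ (sym k-val) (cong suc neutral) ⟩
    (k ℕ.+ toℕ o) ∸ (2 ℕ.+ toℕ o)      ≡⟨ cong₂ _∸_ (ℕₚ.+-comm k (toℕ o)) (ℕₚ.+-comm 2 (toℕ o)) ⟩
    (toℕ o ℕ.+ k) ∸ (toℕ o ℕ.+ 2)      ≡⟨ ℕₚ.[m+n]∸[m+o]≡n∸o (toℕ o) k 2 ⟩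
    k ∸ 2                              ∎
    where open ≡-Reasoning

  a-opening+b≤ : + a (opposite o) + + b ≤ + (k ∸ 2)
  a-opening+b≤ = begin
    + a (opposite o) + + b       ≡⟨ sum<-z₁ ⟨
    sum< (toℕ z₁) (below r)      ≤⟨ sumWhere≤sum _ (below-nonneg r) ⟩
    sum (below r)                ≡⟨ sum-below r ⟩
    + (n ∸ suc (toℕ r))          ≡⟨ cong +_ rows-below-r ⟩
    + (k ∸ 2)                    ∎
    where open ℤₚ.≤-Reasoning

  β≤b+ℓ : + β ≤ + b + ℓ
  β≤b+ℓ = subst (_≤ + b + ℓ) (sym β-val) (ℤₚ.+-monoˡ-≤ ℓ (subst (E ≤_) (sym b-val) E-upper))

  index-closing : ∀ i → suc (suc (toℕ i)) ≡ k → i ≡ opposite r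
  index-closing i i+2≡k = Finₚ.toℕ-injective (sym (begin
    toℕ (opposite r)                    ≡⟨ Finₚ.opposite-prop r ⟩
    n ∸ suc (toℕ r)                     ≡⟨ cong₂ _∸_ (sym k-val) (cong suc neutral) ⟩
    (k ℕ.+ toℕ o) ∸ suc (suc (toℕ o))   ≡⟨ cong (λ m → (m ℕ.+ toℕ o) ∸ suc (suc (toℕ o))) i+2≡k ⟨
    (toℕ i ℕ.+ toℕ o) ∸ toℕ o           ≡⟨ ℕₚ.m+n∸n≡m (toℕ i) (toℕ o) ⟩
    toℕ i                               ∎))
    where open ≡-Reasoning

  index-opening : ∀ j → suc (toℕ j) ≡ k → j ≡ opposite o
  index-opening j j+1≡k = Finₚ.toℕ-injective (sym (begin
    toℕ (opposite o)                    ≡⟨ Finₚ.opposite-prop o ⟩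
    n ∸ suc (toℕ o)                     ≡⟨ cong (_∸ suc (toℕ o)) (sym k-val) ⟩
    (k ℕ.+ toℕ o) ∸ suc (toℕ o)         ≡⟨ cong (λ m → (m ℕ.+ toℕ o) ∸ suc (toℕ o)) j+1≡k ⟨
    (toℕ j ℕ.+ toℕ o) ∸ toℕ o           ≡⟨ ℕₚ.m+n∸n≡m (toℕ j) (toℕ o) ⟩
    toℕ j                               ∎))
    where open ≡-Reasoning

  a-bound : ∀ i → a i ℕ.≤ toℕ i
  a-bound i with a-val i
  ... | y , _ , a≡ = ℤₚ.drop‿+≤+ (begin
    + a i                                 ≡⟨ trans a≡ (belowLeft≡ (opposite i) y) ⟩
    sum< (toℕ y) (below (opposite i))     ≤⟨ sumWhere≤sum _ (below-nonneg (opposite i)) ⟩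
    sum (below (opposite i))              ≡⟨ sum-below (opposite i) ⟩
    + (n ∸ suc (toℕ (opposite i)))        ≡⟨ cong +_ (Finₚ.opposite-prop (opposite i)) ⟨
    + toℕ (opposite (opposite i))         ≡⟨ cong (+_ ∘ toℕ) (Finₚ.opposite-involutive i) ⟩
    + toℕ i                               ∎)
    where open ℤₚ.≤-Reasoning

  conditions : GITConditions n k a b β
  conditions = (3≤k , subst (k ℕ.≤_) k-val (ℕₚ.m≤m+n k (toℕ o))) , a-bound , λ i j i+2≡k j+1≡k →
    subst₂ (λ i j → a i ℕ.< a j × (a i ℕ.+ β ℕ.< a j ℕ.+ b × a j ℕ.+ b ℕ.≤ k ∸ 2))
           (sym (index-closing i i+2≡k)) (sym (index-opening j j+1≡k)) table
    where
    table : a (opposite r) ℕ.< a (opposite o) ×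
            (a (opposite r) ℕ.+ β ℕ.< a (opposite o) ℕ.+ b × a (opposite o) ℕ.+ b ℕ.≤ k ∸ 2)
    table = table-arithmetic ℓ-nonneg a-opening β≤b+ℓ a-opening+b≤
    3≤k : 3 ℕ.≤ k
    3≤k = 1≤k∸2⇒3≤k k (ℕₚ.≤-trans (ℕₚ.≤-trans (s≤s z≤n) (proj₁ table)) (ℕₚ.≤-trans (ℕₚ.m≤m+n _ b) (proj₂ (proj₂ table))))
      where
      1≤k∸2⇒3≤k : ∀ k → 1 ℕ.≤ k ∸ 2 → 3 ℕ.≤ k
      1≤k∸2⇒3≤k (suc (suc (suc _))) _ = s≤s (s≤s (s≤s z≤n))

  a-from : ∀ R x → N R x ≡ 1ℤ → (∀ j → j Fin.< x → N R j ≡ 0ℤ) → + a (opposite R) ≡ sum< (toℕ x) (from R)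
  a-from R x NRx≡1 zeros = trans (a-leftmost R x (leftmost-if-zeros N R NRx≡1 zeros))
    (sum<-cong (toℕ x) (λ j j<x → sym (trans (cong (_+ below R j) (zeros j j<x)) (ℤₚ.+-identityˡ _))))

  Selects : Fin n → Fin n → Set
  Selects R x = from R x ≡ 1ℤ × + a (opposite R) ≡ sum< (toℕ x) (from R)

  unitRow-selects : ∀ R x → (∀ j → N R j ≡ δ x j) → Selects R x
  unitRow-selects R x N≗δx = from-one R x NRx≡1 , a-from R x NRx≡1 (λ j j<x → trans (N≗δx j) (δ-other (Finₚ.<⇒≢ j<x)))
    where
    NRx≡1 : N R x ≡ 1ℤ
    NRx≡1 = trans (N≗δx x) (δ-self x)

  module _ (R : Fin n) (R≡r : R ≡ r) where

    closingRow-at : ∀ j → N R j ≡ δ⁺⁻⁺ x₁ c z₁ j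
    closingRow-at rewrite R≡r = closingRow≗

    closingRow-selects : Selects R x₁
    closingRow-selects rewrite R≡r = from-one r x₁ Nr-x₁ , a-from r x₁ Nr-x₁ Nr-left

    closingColumn-rank : from R z₁ ≡ 1ℤ × + b ≡ sumBetween (toℕ c) (toℕ z₁) (from R)
    closingColumn-rank rewrite R≡r = from-one r z₁ (trans (closingRow≗ z₁) (δ⁺⁻⁺-z x₁<c c<z₁)) ,
      trans b≡ (sumBetween-cong _ _ (λ j c<j j<z₁ →
        sym (trans (cong (_+ below r j) (trans (closingRow≗ j) (δ⁺⁻⁺-between-c-z x₁<c c<z₁ c<j j<z₁))) (ℤₚ.+-identityˡ _))))

-- Uniqueness

module Uniqueness {n k : ℕ} {N N′ : Matrix n} {E E′ : ℤ} {a : Fin n → ℕ} {b β : ℕ}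
                  (H : HasGIT N E k a b β) (H′ : HasGIT N′ E′ k a b β) where

  module A  = Analysis H
  module A′ = Analysis H′

  o≡o′ : A.o ≡ A′.o
  o≡o′ = Finₚ.toℕ-injective (ℕₚ.+-cancelˡ-≡ k _ _ (trans A.k-val (sym A′.k-val)))

  r≡r′ : A.r ≡ A′.r
  r≡r′ = Finₚ.toℕ-injective (trans A.neutral (trans (cong (suc ∘ toℕ) o≡o′) (sym A′.neutral)))

  RowsAgreeAbove : Fin n → Set
  RowsAgreeAbove R = ∀ {i} → i Fin.< R → ∀ j → N i j ≡ N′ i j

  module _ (R : Fin n) (above : RowsAgreeAbove R) where

    from-agrees : ∀ j → A.from R j ≡ A′.from R j
    from-agrees j = trans (A.from≡ R j) (trans (cong (_-_ 1ℤ) (sum<-cong (toℕ R) (λ i i<R → above i<R j)))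
                                               (sym (A′.from≡ R j)))

    selection-unique : ∀ {x x′} → A.Selects R x → A′.Selects R x′ → x ≡ x′
    selection-unique {x′ = x′} (fx≡1 , a≡) (fx′≡1 , a≡′) =
      sum<-injective (A.from-nonneg R) fx≡1 (trans (from-agrees x′) fx′≡1)
        (trans (sym a≡) (trans a≡′ (sum<-cong (toℕ x′) (λ j _ → sym (from-agrees j)))))

    unitRow-agrees : R ≢ A.r → ∀ j → N R j ≡ N′ R j
    unitRow-agrees R≢r with A.unitRow R R≢r | A′.unitRow R (λ R≡r′ → R≢r (trans R≡r′ (sym r≡r′)))
    ... | x , N≗δx | x′ , N′≗δx′ = λ j → trans (N≗δx j) (trans (cong (λ y → δ y j) x≡x′) (sym (N′≗δx′ j)))
      where
      x≡x′ : x ≡ x′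
      x≡x′ = selection-unique (A.unitRow-selects R x N≗δx) (A′.unitRow-selects R x′ N′≗δx′)

    module _ (R≡r : R ≡ A.r) where

      private
        R≡r′ : R ≡ A′.r
        R≡r′ = trans R≡r r≡r′

      x₁≡x₁′ : A.x₁ ≡ A′.x₁
      x₁≡x₁′ = selection-unique (A.closingRow-selects R R≡r) (A′.closingRow-selects R R≡r′)

      c≡c′ : A.c ≡ A′.c
      c≡c′ = sym (δ≡1 {x = A.c} {j = A′.c} (trans (sym (A.openingRow≗ A′.c)) N-o-c′≡1))
        where
        N-o-c′≡1 : N A.o A′.c ≡ 1ℤ
        N-o-c′≡1 = trans (above (subst (A.o Fin.<_) (sym R≡r) A.o<r) A′.c)
                         (trans (cong (λ i → N′ i A′.c) o≡o′) (proj₁ A′.opening))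

      z₁≡z₁′ : A.z₁ ≡ A′.z₁
      z₁≡z₁′ = sumBetween-injective (A.from-nonneg R) A.c<z₁ (subst (Fin._< A′.z₁) (sym c≡c′) A′.c<z₁)
        (proj₁ rank) (trans (from-agrees A′.z₁) (proj₁ rank′)) (begin
          sumBetween (toℕ A.c) (toℕ A.z₁) (A.from R)      ≡⟨ proj₂ rank ⟨
          + b                                             ≡⟨ proj₂ rank′ ⟩
          sumBetween (toℕ A′.c) (toℕ A′.z₁) (A′.from R)   ≡⟨ cong (λ c → sumBetween (toℕ c) (toℕ A′.z₁) (A′.from R)) c≡c′ ⟨
          sumBetween (toℕ A.c) (toℕ A′.z₁) (A′.from R)    ≡⟨ sumWhere-cong _ (λ j _ → from-agrees j) ⟨
          sumBetween (toℕ A.c) (toℕ A′.z₁) (A.from R)     ∎)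
        where
        open ≡-Reasoning
        rank : A.from R A.z₁ ≡ 1ℤ × + b ≡ sumBetween (toℕ A.c) (toℕ A.z₁) (A.from R)
        rank = A.closingColumn-rank R R≡r
        rank′ : A′.from R A′.z₁ ≡ 1ℤ × + b ≡ sumBetween (toℕ A′.c) (toℕ A′.z₁) (A′.from R)
        rank′ = A′.closingColumn-rank R R≡r′

      closingRow-agrees : ∀ j → N R j ≡ N′ R j
      closingRow-agrees j = begin
        N R j                          ≡⟨ A.closingRow-at R R≡r j ⟩
        δ⁺⁻⁺ A.x₁ A.c A.z₁ j           ≡⟨ cong₂ (λ x c → δ⁺⁻⁺ x c A.z₁ j) x₁≡x₁′ c≡c′ ⟩
        δ⁺⁻⁺ A′.x₁ A′.c A.z₁ j         ≡⟨ cong (λ z → δ⁺⁻⁺ A′.x₁ A′.c z j) z₁≡z₁′ ⟩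
        δ⁺⁻⁺ A′.x₁ A′.c A′.z₁ j        ≡⟨ A′.closingRow-at R R≡r′ j ⟨
        N′ R j                         ∎
        where open ≡-Reasoning

  row-agrees : ∀ R → RowsAgreeAbove R → ∀ j → N R j ≡ N′ R j
  row-agrees R above with R Finₚ.≟ A.r
  ... | yes R≡r = closingRow-agrees R above R≡r
  ... | no  R≢r = unitRow-agrees R above R≢r

  N≗N′ : ∀ i j → N i j ≡ N′ i j
  N≗N′ = All.wfRec Finᵢ.<-wellFounded 0ℓ (λ R → ∀ j → N R j ≡ N′ R j) row-agrees

  ℓ≡ℓ′ : A.ℓ ≡ A′.ℓ
  ℓ≡ℓ′ = begin
    A.ℓ                                                  ≡⟨ A.ℓ≡ ⟩
    sumBetween (toℕ A.x₁) (toℕ A.c) (A.below A.o)        ≡⟨ sumWhere-cong _ (λ j _ → below-agrees j) ⟩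
    sumBetween (toℕ A.x₁) (toℕ A.c) (A′.below A′.o)      ≡⟨ cong₂ (λ x c → sumBetween (toℕ x) (toℕ c) (A′.below A′.o))
                                                                  (x₁≡x₁′ A.r (λ _ → N≗N′ _) refl) (c≡c′ A.r (λ _ → N≗N′ _) refl) ⟩
    sumBetween (toℕ A′.x₁) (toℕ A′.c) (A′.below A′.o)    ≡⟨ A′.ℓ≡ ⟨
    A′.ℓ                                                 ∎
    where
    open ≡-Reasoning
    below-agrees : ∀ j → A.below A.o j ≡ A′.below A′.o j
    below-agrees j = trans (sumWhere-cong _ (λ i _ → N≗N′ i j)) (cong (λ o → A′.below o j) o≡o′)

  E≡E′ : E ≡ E′
  E≡E′ = begin
    E                  ≡⟨ cancel E A.ℓ ⟩
    (E + A.ℓ) - A.ℓ    ≡⟨ cong₂ _-_ (sym A.β-val) ℓ≡ℓ′ ⟩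
    + β - A′.ℓ         ≡⟨ cong (_- A′.ℓ) A′.β-val ⟩
    (E′ + A′.ℓ) - A′.ℓ ≡⟨ cancel E′ A′.ℓ ⟨
    E′                 ∎
    where
    open ≡-Reasoning
    cancel : ∀ e l → e ≡ (e + l) - l
    cancel = solve-∀

-- Counting and selecting in Boolean sequences

count : (ℕ → Bool) → ℕ → ℕ
count G zero    = 0
count G (suc m) = bitℕ (G 0) ℕ.+ count (G ∘ suc) m

select : ℕ → (ℕ → Bool) → ℕ → ℕ
select zero    G x       = 0
select (suc m) G x       with G 0
select (suc m) G zero    | true  = 0
select (suc m) G (suc x) | true  = suc (select m (G ∘ suc) x)
select (suc m) G x       | false = suc (select m (G ∘ suc) x)

update : (ℕ → Bool) → ℕ → Bool → ℕ → Bool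
update G x v j = if does (j ℕₚ.≟ x) then v else G j

update-same : ∀ G x v → update G x v x ≡ v
update-same G x v = cong (if_then v else G x) (dec-true (x ℕₚ.≟ x) refl)

update-other : ∀ G {x} v {j} → j ≢ x → update G x v j ≡ G j
update-other G {x} v {j} j≢x = cong (if_then v else G j) (dec-false (j ℕₚ.≟ x) j≢x)

select-spec : ∀ m G x → x ℕ.< count G m →
              select m G x ℕ.< m × G (select m G x) ≡ true × count G (select m G x) ≡ x
select-spec (suc m) G x x<count with G 0 in G₀≡
select-spec (suc m) G zero    _             | true  = s≤s z≤n , G₀≡ , refl
select-spec (suc m) G (suc x) (s≤s x<count) | true  =
  let y<m , Gy≡true , count≡x = select-spec m (G ∘ suc) x x<count in
  s≤s y<m , Gy≡true , trans (cong (λ v → bitℕ v ℕ.+ count (G ∘ suc) (select m (G ∘ suc) x)) G₀≡) (cong suc count≡x)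
select-spec (suc m) G x       x<count       | false =
  let y<m , Gy≡true , count≡x = select-spec m (G ∘ suc) x x<count in
  s≤s y<m , Gy≡true , trans (cong (λ v → bitℕ v ℕ.+ count (G ∘ suc) (select m (G ∘ suc) x)) G₀≡) count≡x

count-snoc : ∀ G m → count G (suc m) ≡ count G m ℕ.+ bitℕ (G m)
count-snoc G zero    = ℕₚ.+-identityʳ (bitℕ (G 0))
count-snoc G (suc m) = trans (cong (bitℕ (G 0) ℕ.+_) (count-snoc (G ∘ suc) m)) (sym (ℕₚ.+-assoc (bitℕ (G 0)) _ _))

count-cong : ∀ {G G′} m → (∀ j → j ℕ.< m → G j ≡ G′ j) → count G m ≡ count G′ m
count-cong zero    G≗G′ = refl
count-cong (suc m) G≗G′ = cong₂ ℕ._+_ (cong bitℕ (G≗G′ 0 (s≤s z≤n))) (count-cong m (λ j j<m → G≗G′ (suc j) (s≤s j<m)))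

count-mono : ∀ G {m m′} → m ℕ.≤ m′ → count G m ℕ.≤ count G m′
count-mono G {zero}  _         = z≤n
count-mono G {suc m} (s≤s m≤m′) = ℕₚ.+-monoʳ-≤ (bitℕ (G 0)) (count-mono (G ∘ suc) m≤m′)

count≡0 : ∀ G m → count G m ≡ 0 → ∀ j → j ℕ.< m → G j ≡ false
count≡0 G (suc m) none j j<m with G 0 in G₀≡
count≡0 G (suc m) none zero    _         | false = G₀≡
count≡0 G (suc m) none (suc j) (s≤s j<m) | false = count≡0 (G ∘ suc) m none j j<m

count-update : ∀ G {x} v m → x ℕ.< m → count (update G x v) m ℕ.+ bitℕ (G x) ≡ count G m ℕ.+ bitℕ v
count-update G {zero}  v (suc m) _         = swap (bitℕ v) (count (G ∘ suc) m) (bitℕ (G 0))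
  where
  swap : ∀ x y z → x ℕ.+ y ℕ.+ z ≡ z ℕ.+ y ℕ.+ x
  swap = ℕ-Solver.solve-∀
count-update G {suc x} v (suc m) (s≤s x<m) = begin
  bitℕ (G 0) ℕ.+ count (update (G ∘ suc) x v) m ℕ.+ bitℕ (G (suc x))   ≡⟨ ℕₚ.+-assoc (bitℕ (G 0)) _ _ ⟩
  bitℕ (G 0) ℕ.+ (count (update (G ∘ suc) x v) m ℕ.+ bitℕ (G (suc x))) ≡⟨ cong (bitℕ (G 0) ℕ.+_) (count-update (G ∘ suc) v m x<m) ⟩
  bitℕ (G 0) ℕ.+ (count (G ∘ suc) m ℕ.+ bitℕ v)                       ≡⟨ ℕₚ.+-assoc (bitℕ (G 0)) _ _ ⟨
  bitℕ (G 0) ℕ.+ count (G ∘ suc) m ℕ.+ bitℕ v                         ∎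
  where open ≡-Reasoning

remove-step : ∀ G {x} j → G x ≡ true → bit (G j) - bit (update G x false j) ≡ bit (does (j ℕₚ.≟ x))
remove-step G {x} j Gx≡true with j ℕₚ.≟ x
... | yes refl = trans (cong₂ (λ v u → bit v - bit u) Gx≡true (update-same G x false))
                       (cong bit (sym (dec-true (x ℕₚ.≟ x) refl)))
... | no  j≢x  = trans (cong (λ u → bit (G j) - bit u) (update-other G false j≢x))
                       (trans (ℤₚ.+-inverseʳ (bit (G j))) (cong bit (sym (dec-false (j ℕₚ.≟ x) j≢x))))

insert-step : ∀ G {x} j → G x ≡ false → bit (G j) - bit (update G x true j) ≡ - bit (does (j ℕₚ.≟ x))
insert-step G {x} j Gx≡false with j ℕₚ.≟ x
... | yes refl = trans (cong₂ (λ v u → bit v - bit u) Gx≡false (update-same G x true))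
                       (cong (-_ ∘ bit) (sym (dec-true (x ℕₚ.≟ x) refl)))
... | no  j≢x  = trans (cong (λ u → bit (G j) - bit u) (update-other G true j≢x))
                       (trans (ℤₚ.+-inverseʳ (bit (G j))) (cong (-_ ∘ bit) (sym (dec-false (j ℕₚ.≟ x) j≢x))))

count-remove : ∀ G {x} m → x ℕ.< m → G x ≡ true → count (update G x false) m ℕ.+ 1 ≡ count G m
count-remove G {x} m x<m Gx≡true =
  trans (cong (λ v → count (update G x false) m ℕ.+ bitℕ v) (sym Gx≡true))
        (trans (count-update G false m x<m) (ℕₚ.+-identityʳ _))

count-insert : ∀ G {x} m → x ℕ.< m → G x ≡ false → count (update G x true) m ≡ count G m ℕ.+ 1
count-insert G {x} m x<m Gx≡false =
  trans (sym (ℕₚ.+-identityʳ _))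
        (trans (cong (λ v → count (update G x true) m ℕ.+ bitℕ v) (sym Gx≡false)) (count-update G true m x<m))

count-<ᵇ : ∀ m → count (λ j → j ℕ.<ᵇ m) m ≡ m
count-<ᵇ zero    = refl
count-<ᵇ (suc m) = cong suc (count-<ᵇ m)

sum<-count : ∀ G m → m ℕ.≤ n → sum< {n} m (λ j → bit (G (toℕ j))) ≡ + count G m
sum<-count {n}     G zero    _         = sum<-zero {n} (λ j → bit (G (toℕ j)))
sum<-count {suc n} G (suc m) (s≤s m≤n) = cong (_+_ (bit (G 0))) (sum<-count (G ∘ suc) m m≤n)

-- Construction of an element with a given table

construction-arithmetic : ∀ {A₁ A₂ b β : ℕ} {ℓ cv : ℤ} → + A₂ ≡ (+ A₁ + 1ℤ) + ℓ → + A₂ + + b ≡ (+ A₂ + 0ℤ) + cv →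
  A₁ ℕ.+ β ℕ.< A₂ ℕ.+ b → cv ≡ + b × (- ℓ ≤ + β - ℓ × + β - ℓ ≤ cv)
construction-arithmetic {A₁} {A₂} {b} {β} {ℓ} {cv} ℓ-eq cv-eq A₁+β<A₂+b = cv≡b , lower , upper
  where
  open ℤₚ.≤-Reasoning
  cancel : ∀ x y → (x + y) - x ≡ y
  cancel = solve-∀
  cancel₀ : ∀ x y → ((x + 0ℤ) + y) - x ≡ y
  cancel₀ = solve-∀
  cv≡b : cv ≡ + b
  cv≡b = begin-equality
    cv                           ≡⟨ cancel₀ (+ A₂) cv ⟨
    ((+ A₂ + 0ℤ) + cv) - + A₂    ≡⟨ cong (_- + A₂) cv-eq ⟨
    (+ A₂ + + b) - + A₂          ≡⟨ cancel (+ A₂) (+ b) ⟩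
    + b                          ∎
  lower : - ℓ ≤ + β - ℓ
  lower = subst (_≤ + β - ℓ) (ℤₚ.+-identityˡ (- ℓ)) (ℤₚ.+-monoˡ-≤ (- ℓ) (ℤ.+≤+ z≤n))
  upper : + β - ℓ ≤ cv
  upper = begin
    + β - ℓ                                ≡⟨ cong (λ l → + β - l) (trans (sym (cancel (+ A₁ + 1ℤ) ℓ)) (cong (_- (+ A₁ + 1ℤ)) (sym ℓ-eq))) ⟩
    + β - (+ A₂ - (+ A₁ + 1ℤ))             ≡⟨ rearrange (+ A₁) (+ A₂) (+ β) ⟩
    (1ℤ + (+ A₁ + + β)) - + A₂             ≤⟨ ℤₚ.+-monoˡ-≤ (- + A₂) (ℤ.+≤+ A₁+β<A₂+b) ⟩
    (+ A₂ + + b) - + A₂                    ≡⟨ cancel (+ A₂) (+ b) ⟩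
    + b                                    ≡⟨ cv≡b ⟨
    cv                                     ∎
    where
    rearrange : ∀ a₁ a₂ β → β - (a₂ - (a₁ + 1ℤ)) ≡ (1ℤ + (a₁ + β)) - a₂
    rearrange = solve-∀

extend : (Fin n → ℕ) → ℕ → ℕ
extend {zero}  a _       = 0
extend {suc n} a zero    = a zero
extend {suc n} a (suc m) = extend (a ∘ suc) m

extend-toℕ : ∀ (a : Fin n → ℕ) i → extend a (toℕ i) ≡ a i
extend-toℕ a zero    = refl
extend-toℕ a (suc i) = extend-toℕ (a ∘ suc) i

module Construction {n k : ℕ} {a : Fin n → ℕ} {b β : ℕ} (C : GITConditions n k a b β) where

  -- Row t (from 0 at the top) has paper index n + 1 - i for i = n - t, so its entry is a_i.
  code : ℕ → ℕ
  code t = extend a (n ∸ suc t)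

  rO rC : ℕ
  rO = n ∸ k
  rC = suc rO

  removeSelected : ℕ → (ℕ → Bool) → ℕ → Bool
  removeSelected t G = update G (select n G (code t)) false

  closingStep : (ℕ → Bool) → ℕ → ℕ → Bool
  closingStep G c = update (update (update G (select n G (code rC)) false) (select n G (code rO ℕ.+ b)) false) c true

  -- avail t j is 1 minus the sum of column j over rows 0 … t - 1, so row t of the matrix is
  -- avail t - avail (t + 1). The closing row puts its 1s at the code rC-th and
  -- (code rO + b)-th available columns and makes the opening column c available again.
  avail : ℕ → ℕ → Bool
  avail zero          = λ j → j ℕ.<ᵇ n
  avail (suc zero)    = removeSelected 0 (avail 0)
  avail (suc (suc t)) =
    if does (suc t ℕₚ.≟ rC) then closingStep (avail (suc t)) (select n (avail t) (code t))
                           else removeSelected (suc t) (avail (suc t))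

  pick : ℕ → ℕ
  pick t = select n (avail t) (code t)

  c q cc : ℕ
  c  = pick rO
  q  = select n (avail rC) (code rC)
  cc = select n (avail rC) (code rO ℕ.+ b)

  avail-generic : ∀ t → t ≢ rC → ∀ j → avail (suc t) j ≡ update (avail t) (pick t) false j
  avail-generic zero    _    j = refl
  avail-generic (suc t) t≢rC j =
    cong (λ d → (if d then closingStep (avail (suc t)) (pick t) else removeSelected (suc t) (avail (suc t))) j)
         (dec-false (suc t ℕₚ.≟ rC) t≢rC)

  G₀ G₁ G₂ G₃ : ℕ → Bool
  G₀ = avail rC
  G₁ = update G₀ q false
  G₂ = update G₁ cc false
  G₃ = update G₂ c true

  avail-closing : ∀ j → avail (suc rC) j ≡ G₃ j
  avail-closing j = cong (λ d → (if d then closingStep (avail rC) c else removeSelected rC (avail rC)) j)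
                         (dec-true (rC ℕₚ.≟ rC) refl)

  private
    true≢false : true ≢ false
    true≢false ()

    3≤k : 3 ℕ.≤ k
    3≤k = proj₁ (proj₁ C)

    k≤n : k ℕ.≤ n
    k≤n = proj₂ (proj₁ C)

    n∸t≡1+n∸[1+t] : ∀ {t} → t ℕ.< n → n ∸ t ≡ suc (n ∸ suc t)
    n∸t≡1+n∸[1+t] t<n = ℕₚ.+-∸-assoc 1 t<n

  rC<n : rC ℕ.< n
  rC<n = subst (suc rC ℕ.≤_) (ℕₚ.m+[n∸m]≡n k≤n) (ℕₚ.+-monoˡ-≤ rO (ℕₚ.≤-trans (ℕₚ.n≤1+n 2) 3≤k))

  rO<n : rO ℕ.< n
  rO<n = ℕₚ.<-trans (ℕₚ.n<1+n rO) rC<n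

  k≡1+n∸rC : k ≡ suc (n ∸ rC)
  k≡1+n∸rC = begin
    k                  ≡⟨ ℕₚ.m∸[m∸n]≡n k≤n ⟨
    n ∸ rO             ≡⟨ n∸t≡1+n∸[1+t] rO<n ⟩
    suc (n ∸ rC)       ∎
    where open ≡-Reasoning

  k≡2+n∸[1+rC] : k ≡ suc (suc (n ∸ suc rC))
  k≡2+n∸[1+rC] = trans k≡1+n∸rC (cong suc (n∸t≡1+n∸[1+t] rC<n))

  code≡ : ∀ R → code (toℕ R) ≡ a (opposite R)
  code≡ R = trans (cong (extend a) (sym (Finₚ.opposite-prop R))) (extend-toℕ a (opposite R))

  code-fromℕ< : ∀ {t} (t<n : t ℕ.< n) → code t ≡ a (opposite (fromℕ< t<n))
  code-fromℕ< t<n = trans (cong code (sym (Finₚ.toℕ-fromℕ< t<n))) (code≡ (fromℕ< t<n))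

  code<n∸t : ∀ t → t ℕ.< n → code t ℕ.< n ∸ t
  code<n∸t t t<n = begin-strict
    code t                                   ≡⟨ code-fromℕ< t<n ⟩
    a (opposite (fromℕ< t<n))                ≤⟨ proj₁ (proj₂ C) (opposite (fromℕ< t<n)) ⟩
    toℕ (opposite (fromℕ< t<n))              ≡⟨ Finₚ.opposite-prop (fromℕ< t<n) ⟩
    n ∸ suc (toℕ (fromℕ< t<n))               ≡⟨ cong (λ m → n ∸ suc m) (Finₚ.toℕ-fromℕ< t<n) ⟩
    n ∸ suc t                                <⟨ ℕₚ.n<1+n _ ⟩
    suc (n ∸ suc t)                          ≡⟨ n∸t≡1+n∸[1+t] t<n ⟨
    n ∸ t                                    ∎
    where open ℕₚ.≤-Reasoning

  A₁ A₂ : ℕ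
  A₁ = code rC
  A₂ = code rO

  table : A₁ ℕ.< A₂ × (A₁ ℕ.+ β ℕ.< A₂ ℕ.+ b × A₂ ℕ.+ b ℕ.≤ k ∸ 2)
  table = subst₂ (λ u v → u ℕ.< v × (u ℕ.+ β ℕ.< v ℕ.+ b × v ℕ.+ b ℕ.≤ k ∸ 2))
                 (sym (code-fromℕ< rC<n)) (sym (code-fromℕ< rO<n))
                 (proj₂ (proj₂ C) (opposite (fromℕ< rC<n)) (opposite (fromℕ< rO<n))
                                      (sym (trans k≡2+n∸[1+rC] (cong (λ m → suc (suc m)) opposite-rC)))
                                      (sym (trans k≡1+n∸rC (cong suc opposite-rO))))
    where
    opposite-rC : n ∸ suc rC ≡ toℕ (opposite (fromℕ< rC<n))
    opposite-rC = sym (trans (Finₚ.opposite-prop _) (cong (λ m → n ∸ suc m) (Finₚ.toℕ-fromℕ< rC<n)))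
    opposite-rO : n ∸ rC ≡ toℕ (opposite (fromℕ< rO<n))
    opposite-rO = sym (trans (Finₚ.opposite-prop _) (cong (λ m → n ∸ suc m) (Finₚ.toℕ-fromℕ< rO<n)))

  pick-spec : ∀ t → t ℕ.< n → count (avail t) n ≡ n ∸ t →
              pick t ℕ.< n × avail t (pick t) ≡ true × count (avail t) (pick t) ≡ code t
  pick-spec t t<n count≡ = select-spec n (avail t) (code t) (subst (code t ℕ.<_) (sym count≡) (code<n∸t t t<n))

  count-generic : ∀ t → t ≢ rC → t ℕ.< n → count (avail t) n ≡ n ∸ t → count (avail (suc t)) n ≡ n ∸ suc t
  count-generic t t≢rC t<n count≡ = ℕₚ.suc-injective (begin
    suc (count (avail (suc t)) n)                    ≡⟨ ℕₚ.+-comm 1 _ ⟩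
    count (avail (suc t)) n ℕ.+ 1                    ≡⟨ cong (ℕ._+ 1) (count-cong n (λ j _ → avail-generic t t≢rC j)) ⟩
    count (update (avail t) (pick t) false) n ℕ.+ 1  ≡⟨ count-remove (avail t) n pick<n avail-pick ⟩
    count (avail t) n                                ≡⟨ count≡ ⟩
    n ∸ t                                            ≡⟨ n∸t≡1+n∸[1+t] t<n ⟩
    suc (n ∸ suc t)                                  ∎)
    where
    open ≡-Reasoning
    pick<n : pick t ℕ.< n
    pick<n = proj₁ (pick-spec t t<n count≡)
    avail-pick : avail t (pick t) ≡ true
    avail-pick = proj₁ (proj₂ (pick-spec t t<n count≡))

  count-upto-rC : ∀ t → t ℕ.≤ rC → count (avail t) n ≡ n ∸ t
  count-upto-rC zero    _      = count-<ᵇ n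
  count-upto-rC (suc t) t<rC = count-generic t (ℕₚ.<⇒≢ t<rC) (ℕₚ.<-trans t<rC rC<n) (count-upto-rC t (ℕₚ.<⇒≤ t<rC))

  private
    c-spec : c ℕ.< n × avail rO c ≡ true × count (avail rO) c ≡ A₂
    c-spec = pick-spec rO rO<n (count-upto-rC rO (ℕₚ.n≤1+n rO))

    k∸2<count : k ∸ 2 ℕ.< count (avail rC) n
    k∸2<count = begin-strict
      k ∸ 2                      ≡⟨ cong (_∸ 2) k≡2+n∸[1+rC] ⟩
      n ∸ suc rC                 <⟨ ℕₚ.n<1+n _ ⟩
      suc (n ∸ suc rC)           ≡⟨ n∸t≡1+n∸[1+t] rC<n ⟨
      n ∸ rC                     ≡⟨ count-upto-rC rC ℕₚ.≤-refl ⟨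
      count (avail rC) n         ∎
      where open ℕₚ.≤-Reasoning

    A₂+b≤k∸2 : A₂ ℕ.+ b ℕ.≤ k ∸ 2
    A₂+b≤k∸2 = proj₂ (proj₂ table)

    q-spec : q ℕ.< n × avail rC q ≡ true × count (avail rC) q ≡ A₁
    q-spec = select-spec n (avail rC) A₁
      (ℕₚ.<-≤-trans (proj₁ table) (ℕₚ.≤-trans (ℕₚ.m≤m+n A₂ b) (ℕₚ.≤-trans A₂+b≤k∸2 (ℕₚ.<⇒≤ k∸2<count))))

    cc-spec : cc ℕ.< n × avail rC cc ≡ true × count (avail rC) cc ≡ A₂ ℕ.+ b
    cc-spec = select-spec n (avail rC) (A₂ ℕ.+ b) (ℕₚ.≤-<-trans A₂+b≤k∸2 k∸2<count)

  avail-rC : ∀ j → avail rC j ≡ update (avail rO) c false j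
  avail-rC = avail-generic rO (ℕₚ.<⇒≢ (ℕₚ.n<1+n rO))

  avail-rC-c : avail rC c ≡ false
  avail-rC-c = trans (avail-rC c) (update-same (avail rO) c false)

  count-rC-c : count (avail rC) c ≡ A₂
  count-rC-c = trans (count-cong c (λ j j<c → trans (avail-rC j) (update-other (avail rO) false (ℕₚ.<⇒≢ j<c))))
                     (proj₂ (proj₂ c-spec))

  q<c : q ℕ.< c
  q<c with ℕₚ.<-cmp q c
  ... | tri< q<c _ _ = q<c
  ... | tri≈ _ q≡c _ = ⊥-elim (true≢false (trans (sym (proj₁ (proj₂ q-spec))) (trans (cong (avail rC) q≡c) avail-rC-c)))
  ... | tri> _ _ c<q = ⊥-elim (ℕₚ.<⇒≱ (proj₁ table)
                         (subst₂ ℕ._≤_ count-rC-c (proj₂ (proj₂ q-spec)) (count-mono (avail rC) (ℕₚ.<⇒≤ c<q))))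

  c<cc : c ℕ.< cc
  c<cc with ℕₚ.<-cmp c cc
  ... | tri< c<cc _ _ = c<cc
  ... | tri≈ _ c≡cc _ = ⊥-elim (true≢false (trans (sym (proj₁ (proj₂ cc-spec))) (trans (cong (avail rC) (sym c≡cc)) avail-rC-c)))
  ... | tri> _ _ cc<c = ⊥-elim (ℕₚ.<-irrefl refl (begin-strict
      A₂                               ≤⟨ ℕₚ.m≤m+n A₂ b ⟩
      A₂ ℕ.+ b                         <⟨ ℕₚ.m<m+n (A₂ ℕ.+ b) (s≤s z≤n) ⟩
      A₂ ℕ.+ b ℕ.+ 1                   ≡⟨ cong₂ (λ s v → s ℕ.+ bitℕ v) (proj₂ (proj₂ cc-spec)) (proj₁ (proj₂ cc-spec)) ⟨
      count (avail rC) cc ℕ.+ bitℕ (avail rC cc) ≡⟨ count-snoc (avail rC) cc ⟨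
      count (avail rC) (suc cc)        ≤⟨ count-mono (avail rC) cc<c ⟩
      count (avail rC) c               ≡⟨ count-rC-c ⟩
      A₂                               ∎))
    where open ℕₚ.≤-Reasoning

  private
    G₁-cc : G₁ cc ≡ true
    G₁-cc = trans (update-other G₀ false (ℕₚ.>⇒≢ (ℕₚ.<-trans q<c c<cc))) (proj₁ (proj₂ cc-spec))

    G₂-c : G₂ c ≡ false
    G₂-c = trans (update-other G₁ false (ℕₚ.<⇒≢ c<cc)) (trans (update-other G₀ false (ℕₚ.>⇒≢ q<c)) avail-rC-c)

  count-closing : count (avail (suc rC)) n ≡ n ∸ suc rC
  count-closing = ℕₚ.suc-injective (begin
    suc (count (avail (suc rC)) n)   ≡⟨ ℕₚ.+-comm 1 _ ⟩
    count (avail (suc rC)) n ℕ.+ 1   ≡⟨ cong (ℕ._+ 1) (count-cong n (λ j _ → avail-closing j)) ⟩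
    count G₃ n ℕ.+ 1                 ≡⟨ cong (ℕ._+ 1) (count-insert G₂ n (proj₁ c-spec) G₂-c) ⟩
    count G₂ n ℕ.+ 1 ℕ.+ 1           ≡⟨ cong (ℕ._+ 1) (count-remove G₁ n (proj₁ cc-spec) G₁-cc) ⟩
    count G₁ n ℕ.+ 1                 ≡⟨ count-remove (avail rC) n (proj₁ q-spec) (proj₁ (proj₂ q-spec)) ⟩
    count (avail rC) n               ≡⟨ count-upto-rC rC ℕₚ.≤-refl ⟩
    n ∸ rC                           ≡⟨ n∸t≡1+n∸[1+t] rC<n ⟩
    suc (n ∸ suc rC)                 ∎)
    where open ≡-Reasoning

  count-avail : ∀ t → t ℕ.≤ n → count (avail t) n ≡ n ∸ t
  count-avail zero    _   = count-<ᵇ n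
  count-avail (suc t) t<n with t ℕₚ.≟ rC
  ... | yes refl = count-closing
  ... | no  t≢rC = count-generic t t≢rC t<n (count-avail t (ℕₚ.<⇒≤ t<n))

  avail-n : ∀ j → j ℕ.< n → avail n j ≡ false
  avail-n = count≡0 (avail n) n (trans (count-avail n ℕₚ.≤-refl) (ℕₚ.n∸n≡0 n))

  N : Matrix n
  N R j = steps (λ t → avail t (toℕ j)) R

  private
    count-at : ∀ (R : Fin n) → count (avail (toℕ R)) n ≡ n ∸ toℕ R
    count-at R = count-avail (toℕ R) (ℕₚ.<⇒≤ (Finₚ.toℕ<n R))

    pick-spec-at : ∀ (R : Fin n) → pick (toℕ R) ℕ.< n × avail (toℕ R) (pick (toℕ R)) ≡ true ×
                                    count (avail (toℕ R)) (pick (toℕ R)) ≡ code (toℕ R)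
    pick-spec-at R = pick-spec (toℕ R) (Finₚ.toℕ<n R) (count-at R)

  pickF : Fin n → Fin n
  pickF R = fromℕ< (proj₁ (pick-spec-at R))

  rOF rCF cF qF ccF : Fin n
  rOF = fromℕ< rO<n
  rCF = fromℕ< rC<n
  cF  = fromℕ< (proj₁ c-spec)
  qF  = fromℕ< (proj₁ q-spec)
  ccF = fromℕ< (proj₁ cc-spec)

  qF<cF : qF Fin.< cF
  qF<cF = subst₂ ℕ._<_ (sym (Finₚ.toℕ-fromℕ< _)) (sym (Finₚ.toℕ-fromℕ< _)) q<c

  cF<ccF : cF Fin.< ccF
  cF<ccF = subst₂ ℕ._<_ (sym (Finₚ.toℕ-fromℕ< _)) (sym (Finₚ.toℕ-fromℕ< _)) c<cc

  genericRow : ∀ R → toℕ R ≢ rC → ∀ j → N R j ≡ δ (pickF R) j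
  genericRow R R≢rC j = begin
    bit (avail (toℕ R) (toℕ j)) - bit (avail (suc (toℕ R)) (toℕ j))
      ≡⟨ cong (λ v → bit (avail (toℕ R) (toℕ j)) - bit v) (avail-generic (toℕ R) R≢rC (toℕ j)) ⟩
    bit (avail (toℕ R) (toℕ j)) - bit (update (avail (toℕ R)) (pick (toℕ R)) false (toℕ j))
      ≡⟨ remove-step (avail (toℕ R)) (toℕ j) (proj₁ (proj₂ (pick-spec-at R))) ⟩
    bit (does (toℕ j ℕₚ.≟ pick (toℕ R)))
      ≡⟨ δ-fromℕ< (proj₁ (pick-spec-at R)) j ⟩
    δ (pickF R) j ∎
    where open ≡-Reasoning

  closingRow : ∀ R → toℕ R ≡ rC → ∀ j → N R j ≡ δ⁺⁻⁺ qF cF ccF j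
  closingRow R R≡rC j = begin
    bit (avail (toℕ R) (toℕ j)) - bit (avail (suc (toℕ R)) (toℕ j))
      ≡⟨ cong₂ (λ u v → bit (u (toℕ j)) - bit v) (cong avail R≡rC) (trans (cong (λ t → avail (suc t) (toℕ j)) R≡rC) (avail-closing (toℕ j))) ⟩
    bit (G₀ (toℕ j)) - bit (G₃ (toℕ j))
      ≡⟨ telescope (bit (G₀ (toℕ j))) (bit (G₁ (toℕ j))) (bit (G₂ (toℕ j))) (bit (G₃ (toℕ j))) ⟩
    (bit (G₀ (toℕ j)) - bit (G₁ (toℕ j))) + ((bit (G₁ (toℕ j)) - bit (G₂ (toℕ j))) + (bit (G₂ (toℕ j)) - bit (G₃ (toℕ j))))
      ≡⟨ cong₂ _+_ (remove-step G₀ (toℕ j) (proj₁ (proj₂ q-spec)))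
                   (cong₂ _+_ (remove-step G₁ (toℕ j) G₁-cc) (insert-step G₂ (toℕ j) G₂-c)) ⟩
    bit (does (toℕ j ℕₚ.≟ q)) + (bit (does (toℕ j ℕₚ.≟ cc)) + - bit (does (toℕ j ℕₚ.≟ c)))
      ≡⟨ cong₂ _+_ (δ-fromℕ< (proj₁ q-spec) j) (cong₂ _-_ (δ-fromℕ< (proj₁ cc-spec) j) (δ-fromℕ< (proj₁ c-spec) j)) ⟩
    δ⁺⁻⁺ qF cF ccF j ∎
    where
    open ≡-Reasoning
    telescope : ∀ w x y z → w - z ≡ (w - x) + ((x - y) + (y - z))
    telescope = solve-∀

  availℤ : ℕ → Fin n → ℤ
  availℤ t j = bit (avail t (toℕ j))

  below≡availℤ : ∀ R j → sum> (toℕ R) (λ i → N i j) ≡ availℤ (suc (toℕ R)) j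
  below≡availℤ R j = begin
    sum> (toℕ R) (λ i → N i j)                       ≡⟨ sum>-steps {n} (λ t → avail t (toℕ j)) (toℕ R) (Finₚ.toℕ<n R) ⟩
    availℤ (suc (toℕ R)) j - bit (avail n (toℕ j))   ≡⟨ cong (λ v → availℤ (suc (toℕ R)) j - bit v) (avail-n (toℕ j) (Finₚ.toℕ<n j)) ⟩
    availℤ (suc (toℕ R)) j - 0ℤ                      ≡⟨ ℤₚ.+-identityʳ _ ⟩
    availℤ (suc (toℕ R)) j                           ∎
    where open ≡-Reasoning

  sum<-availℤ : ∀ t (x : Fin n) → sum< (toℕ x) (availℤ t) ≡ + count (avail t) (toℕ x)
  sum<-availℤ t x = sum<-count (avail t) (toℕ x) (ℕₚ.<⇒≤ (Finₚ.toℕ<n x))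

  belowLeft≡count : ∀ R x → belowLeft N R x ≡ + count (avail (suc (toℕ R))) (toℕ x)
  belowLeft≡count R x = trans (belowLeft-byColumns N R x)
    (trans (sum<-cong (toℕ x) (λ j _ → below≡availℤ R j)) (sum<-availℤ (suc (toℕ R)) x))

  belowBetween≡ : ∀ R u v → regionSum N (λ i j → (R <ᵇ i) ∧ ((u <ᵇ j) ∧ (j <ᵇ v))) ≡
                             sumBetween (toℕ u) (toℕ v) (availℤ (suc (toℕ R)))
  belowBetween≡ R u v = trans (belowBetween-byColumns N R u v) (sumBetween-cong (toℕ u) (toℕ v) (λ j _ _ → below≡availℤ R j))

  ℓ cv : ℤ
  ℓ  = ellVal N rOF cF qF
  cv = cVal N rCF cF ccF

  private
    sum<-availℤ-rC : ∀ {x} (x<n : x ℕ.< n) → sum< (toℕ (fromℕ< x<n)) (availℤ rC) ≡ + count (avail rC) x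
    sum<-availℤ-rC x<n = trans (sum<-availℤ rC (fromℕ< x<n)) (cong (λ x → + count (avail rC) x) (Finₚ.toℕ-fromℕ< x<n))

    availℤ-rC : ∀ {x} (x<n : x ℕ.< n) → availℤ rC (fromℕ< x<n) ≡ bit (avail rC x)
    availℤ-rC x<n = cong (λ x → bit (avail rC x)) (Finₚ.toℕ-fromℕ< x<n)

  ℓ-eq : + A₂ ≡ (+ A₁ + 1ℤ) + ℓ
  ℓ-eq = begin
    + A₂                                       ≡⟨ trans (sum<-availℤ-rC (proj₁ c-spec)) (cong +_ count-rC-c) ⟨
    sum< (toℕ cF) (availℤ rC)                  ≡⟨ sum<-splitAt (availℤ rC) qF qF<cF ⟩
    (sum< (toℕ qF) (availℤ rC) + availℤ rC qF) + sumBetween (toℕ qF) (toℕ cF) (availℤ rC)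
      ≡⟨ cong₂ (λ s t → (s + t) + sumBetween (toℕ qF) (toℕ cF) (availℤ rC)) (trans (sum<-availℤ-rC (proj₁ q-spec)) (cong +_ (proj₂ (proj₂ q-spec))))
                                      (trans (availℤ-rC (proj₁ q-spec)) (cong bit (proj₁ (proj₂ q-spec)))) ⟩
    (+ A₁ + 1ℤ) + sumBetween (toℕ qF) (toℕ cF) (availℤ rC)
      ≡⟨ cong (λ t → (+ A₁ + 1ℤ) + sumBetween (toℕ qF) (toℕ cF) (availℤ (suc t))) (Finₚ.toℕ-fromℕ< rO<n) ⟨
    (+ A₁ + 1ℤ) + sumBetween (toℕ qF) (toℕ cF) (availℤ (suc (toℕ rOF)))
      ≡⟨ cong (_+_ (+ A₁ + 1ℤ)) (belowBetween≡ rOF qF cF) ⟨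
    (+ A₁ + 1ℤ) + ℓ                            ∎
    where open ≡-Reasoning

  cv-eq : + A₂ + + b ≡ (+ A₂ + 0ℤ) + cv
  cv-eq = begin
    + A₂ + + b                                  ≡⟨ trans (sum<-availℤ-rC (proj₁ cc-spec)) (cong +_ (proj₂ (proj₂ cc-spec))) ⟨
    sum< (toℕ ccF) (availℤ rC)                  ≡⟨ sum<-splitAt (availℤ rC) cF cF<ccF ⟩
    (sum< (toℕ cF) (availℤ rC) + availℤ rC cF) + sumBetween (toℕ cF) (toℕ ccF) (availℤ rC)
      ≡⟨ cong₂ (λ s t → (s + t) + sumBetween (toℕ cF) (toℕ ccF) (availℤ rC))
               (trans (sum<-availℤ-rC (proj₁ c-spec)) (cong +_ count-rC-c)) (trans (availℤ-rC (proj₁ c-spec)) (cong bit avail-rC-c)) ⟩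
    (+ A₂ + 0ℤ) + sumBetween (toℕ cF) (toℕ ccF) (availℤ rC)
      ≡⟨ cong (_+_ (+ A₂ + 0ℤ)) (sumBetween-cong (toℕ cF) (toℕ ccF) unchanged) ⟩
    (+ A₂ + 0ℤ) + sumBetween (toℕ cF) (toℕ ccF) (availℤ (suc rC))
      ≡⟨ cong (λ t → (+ A₂ + 0ℤ) + sumBetween (toℕ cF) (toℕ ccF) (availℤ (suc t))) (Finₚ.toℕ-fromℕ< rC<n) ⟨
    (+ A₂ + 0ℤ) + sumBetween (toℕ cF) (toℕ ccF) (availℤ (suc (toℕ rCF)))
      ≡⟨ cong (_+_ (+ A₂ + 0ℤ)) (belowBetween≡ rCF cF ccF) ⟨
    (+ A₂ + 0ℤ) + cv                            ∎
    where
    open ≡-Reasoning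
    unchanged : ∀ j → toℕ cF ℕ.< toℕ j → toℕ j ℕ.< toℕ ccF → availℤ rC j ≡ availℤ (suc rC) j
    unchanged j cF<j j<ccF = cong bit (sym (begin
      avail (suc rC) (toℕ j)  ≡⟨ avail-closing (toℕ j) ⟩
      G₃ (toℕ j)              ≡⟨ update-other G₂ true (ℕₚ.>⇒≢ c<j) ⟩
      G₂ (toℕ j)              ≡⟨ update-other G₁ false (ℕₚ.<⇒≢ j<cc) ⟩
      G₁ (toℕ j)              ≡⟨ update-other G₀ false (ℕₚ.>⇒≢ (ℕₚ.<-trans q<c c<j)) ⟩
      G₀ (toℕ j)              ∎))
      where
      c<j : c ℕ.< toℕ j
      c<j = subst (ℕ._< toℕ j) (Finₚ.toℕ-fromℕ< _) cF<j
      j<cc : toℕ j ℕ.< cc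
      j<cc = subst (toℕ j ℕ.<_) (Finₚ.toℕ-fromℕ< _) j<ccF

  E : ℤ
  E = + β - ℓ

  values : cv ≡ + b × (- ℓ ≤ E × E ≤ cv)
  values = construction-arithmetic ℓ-eq cv-eq (proj₁ (proj₂ table))

  update-false : ∀ G {x j} → G j ≡ false → update G x false j ≡ false
  update-false G {x} {j} Gj≡false with j ℕₚ.≟ x
  ... | yes refl = update-same G x false
  ... | no  j≢x  = trans (update-other G false j≢x) Gj≡false

  avail-stays-false : ∀ {s} t j → s ℕ.≤ t → t ℕ.≤ rC → avail s j ≡ false → avail t j ≡ false
  avail-stays-false zero    j z≤n _ avail≡false = avail≡false
  avail-stays-false (suc t) j s≤1+t 1+t≤rC avail≡false with ℕₚ.m≤n⇒m<n∨m≡n s≤1+t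
  ... | inj₂ refl   = avail≡false
  ... | inj₁ s<1+t = trans (avail-generic t (ℕₚ.<⇒≢ 1+t≤rC) j)
      (update-false (avail t) (avail-stays-false t j (ℕₚ.≤-pred s<1+t) (ℕₚ.<⇒≤ 1+t≤rC) avail≡false))

  private
    toℕ-rOF : toℕ rOF ≡ rO
    toℕ-rOF = Finₚ.toℕ-fromℕ< rO<n

    toℕ-rCF : toℕ rCF ≡ rC
    toℕ-rCF = Finₚ.toℕ-fromℕ< rC<n

    toℕ-pickF : ∀ R → toℕ (pickF R) ≡ pick (toℕ R)
    toℕ-pickF R = Finₚ.toℕ-fromℕ< _

  N-entries : ∀ i j → (N i j ≡ 1ℤ ⊎ N i j ≡ 0ℤ) ⊎ N i j ≡ -1ℤ
  N-entries i j = step-entry (avail (toℕ i) (toℕ j)) (avail (suc (toℕ i)) (toℕ j))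
    where
    step-entry : ∀ u v → (bit u - bit v ≡ 1ℤ ⊎ bit u - bit v ≡ 0ℤ) ⊎ bit u - bit v ≡ -1ℤ
    step-entry true  true  = inj₁ (inj₂ refl)
    step-entry true  false = inj₁ (inj₁ refl)
    step-entry false true  = inj₂ refl
    step-entry false false = inj₁ (inj₂ refl)

  rowAlternating : ∀ i → Alternating (nz (N i))
  rowAlternating i with toℕ i ℕₚ.≟ rC
  ... | yes i≡rC = subst Alternating (nz-cong (λ j → sym (closingRow i i≡rC j))) (δ⁺⁻⁺-alternating qF<cF cF<ccF)
  ... | no  i≢rC = subst Alternating (nz-cong (λ j → sym (genericRow i i≢rC j))) (δ-alternating (pickF i))

  colAlternating : ∀ j → Alternating (nz (λ i → N i j))
  colAlternating j = proj₁ (steps-alternating n (λ t → avail t (toℕ j)) (avail-n (toℕ j) (Finₚ.toℕ<n j)))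
                           (Equivalence.to T-≡ (ℕₚ.<⇒<ᵇ (Finₚ.toℕ<n j)))

  isASM : IsASM N
  isASM = N-entries
        , (λ i → subst (Alternating ∘ nonzeros) (sym (Listₚ.map-tabulate id (N i))) (rowAlternating i))
        , (λ j → subst (Alternating ∘ nonzeros) (sym (Listₚ.map-tabulate id (λ i → N i j))) (colAlternating j))

  oneNeg : OneNegAt N rCF cF
  oneNeg = trans (closingRow rCF toℕ-rCF cF) (δ⁺⁻⁺-c qF<cF cF<ccF) , only-at
    where
    only-at : ∀ i j → N i j ≡ -1ℤ → i ≡ rCF × j ≡ cF
    only-at i j Nij≡-1 with toℕ i ℕₚ.≟ rC
    ... | yes i≡rC = Finₚ.toℕ-injective (trans i≡rC (sym toℕ-rCF))
                   , δ⁺⁻⁺≡-1 qF<cF cF<ccF j (trans (sym (closingRow i i≡rC j)) Nij≡-1)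
    ... | no  i≢rC with () ← trans (sym (genericRow i i≢rC j)) Nij≡-1

  opening : HighestOneInCol N cF rOF
  opening = trans (genericRow rOF rOF≢rC cF) (trans (cong (λ x → δ x cF) pickF-rOF) (δ-self cF)) , no-one-above
    where
    rOF≢rC : toℕ rOF ≢ rC
    rOF≢rC rOF≡rC = ℕₚ.n≮n rC (subst (ℕ._< rC) (trans (sym toℕ-rOF) rOF≡rC) (ℕₚ.n<1+n rO))
    pickF-rOF : pickF rOF ≡ cF
    pickF-rOF = Finₚ.toℕ-injective (trans (toℕ-pickF rOF) (trans (cong pick toℕ-rOF) (sym (Finₚ.toℕ-fromℕ< _))))
    no-one-above : ∀ i → i Fin.< rOF → N i cF ≢ 1ℤ
    no-one-above i i<rOF Nic≡1 = true≢false (trans (sym (proj₁ (proj₂ c-spec)))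
      (avail-stays-false rO c i<rO (ℕₚ.n≤1+n rO) (begin
        avail (suc (toℕ i)) c                               ≡⟨ avail-generic (toℕ i) i≢rC c ⟩
        update (avail (toℕ i)) (pick (toℕ i)) false c       ≡⟨ cong (λ x → update (avail (toℕ i)) (pick (toℕ i)) false x) c≡pick ⟩
        update (avail (toℕ i)) (pick (toℕ i)) false (pick (toℕ i)) ≡⟨ update-same (avail (toℕ i)) (pick (toℕ i)) false ⟩
        false                                               ∎)))
      where
      open ≡-Reasoning
      i<rO : toℕ i ℕ.< rO
      i<rO = subst (toℕ i ℕ.<_) toℕ-rOF i<rOF
      i≢rC : toℕ i ≢ rC
      i≢rC = ℕₚ.<⇒≢ (ℕₚ.<-trans i<rO (ℕₚ.n<1+n rO))
      c≡pick : c ≡ pick (toℕ i)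
      c≡pick = trans (sym (Finₚ.toℕ-fromℕ< _))
                     (trans (cong toℕ (δ≡1 (trans (sym (genericRow i i≢rC cF)) Nic≡1))) (toℕ-pickF i))

  leading : LeadingOneAt N rOF cF rCF qF
  leading = subst₂ ℕ._<_ (sym toℕ-rOF) (sym toℕ-rCF) (ℕₚ.n<1+n rO) , qF<cF
          , trans (closingRow rCF toℕ-rCF qF) (δ⁺⁻⁺-x qF<cF cF<ccF)
          , λ i j rOF<i i<rCF _ _ → ℕₚ.<⇒≱ (subst (ℕ._< toℕ i) toℕ-rOF rOF<i) (ℕₚ.≤-pred (subst (toℕ i ℕ.<_) toℕ-rCF i<rCF))

  closing : ClosingOneAt N rCF cF ccF
  closing = cF<ccF , trans (closingRow rCF toℕ-rCF ccF) (δ⁺⁻⁺-z qF<cF cF<ccF)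

  code≡belowLeft : ∀ R x → count (avail (toℕ R)) (toℕ x) ≡ code (toℕ R) →
                   (∀ j → j ℕ.< toℕ x → avail (suc (toℕ R)) j ≡ avail (toℕ R) j) →
                   + a (opposite R) ≡ belowLeft N R x
  code≡belowLeft R x count≡code unchanged = sym (begin
    belowLeft N R x                          ≡⟨ belowLeft≡count R x ⟩
    + count (avail (suc (toℕ R))) (toℕ x)    ≡⟨ cong +_ (count-cong (toℕ x) unchanged) ⟩
    + count (avail (toℕ R)) (toℕ x)          ≡⟨ cong +_ count≡code ⟩
    + code (toℕ R)                           ≡⟨ cong +_ (code≡ R) ⟩
    + a (opposite R)                         ∎)
    where open ≡-Reasoning

  row-value : ∀ R → Σ (Fin n) λ x → LeftmostOneAt N R x × (+ a (opposite R) ≡ belowLeft N R x)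
  row-value R with toℕ R ℕₚ.≟ rC
  ... | yes R≡rC = qF
      , leftmost-if-zeros N R (trans (closingRow R R≡rC qF) (δ⁺⁻⁺-x qF<cF cF<ccF))
                              (λ j j<qF → trans (closingRow R R≡rC j) (δ⁺⁻⁺-left qF<cF cF<ccF j<qF))
      , code≡belowLeft R qF
          (subst (λ t → count (avail t) (toℕ qF) ≡ code t) (sym R≡rC)
                 (trans (cong (count (avail rC)) (Finₚ.toℕ-fromℕ< (proj₁ q-spec))) (proj₂ (proj₂ q-spec))))
          (subst (λ t → ∀ j → j ℕ.< toℕ qF → avail (suc t) j ≡ avail t j) (sym R≡rC) unchanged)
    where
    unchanged : ∀ j → j ℕ.< toℕ qF → avail (suc rC) j ≡ avail rC j
    unchanged j j<qF = begin
      avail (suc rC) j  ≡⟨ avail-closing j ⟩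
      G₃ j              ≡⟨ update-other G₂ true (ℕₚ.<⇒≢ (ℕₚ.<-trans j<q q<c)) ⟩
      G₂ j              ≡⟨ update-other G₁ false (ℕₚ.<⇒≢ (ℕₚ.<-trans j<q (ℕₚ.<-trans q<c c<cc))) ⟩
      G₁ j              ≡⟨ update-other G₀ false (ℕₚ.<⇒≢ j<q) ⟩
      G₀ j              ∎
      where
      open ≡-Reasoning
      j<q : j ℕ.< q
      j<q = subst (j ℕ.<_) (Finₚ.toℕ-fromℕ< _) j<qF
  ... | no R≢rC = pickF R
      , leftmost-if-zeros N R (trans (genericRow R R≢rC (pickF R)) (δ-self (pickF R)))
                              (λ j j<x → trans (genericRow R R≢rC j) (δ-other (Finₚ.<⇒≢ j<x)))
      , code≡belowLeft R (pickF R)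
          (trans (cong (count (avail (toℕ R))) (toℕ-pickF R)) (proj₂ (proj₂ (pick-spec-at R))))
          (λ j j<x → trans (avail-generic (toℕ R) R≢rC j)
                           (update-other (avail (toℕ R)) false (ℕₚ.<⇒≢ (subst (j ℕ.<_) (toℕ-pickF R) j<x))))

  hasGIT : HasGIT N E k a b β
  hasGIT = record
    { asm     = isASM
    ; r       = rCF
    ; c       = cF
    ; oneNeg  = oneNeg
    ; o       = rOF
    ; opening = opening
    ; neutral = trans toℕ-rCF (cong suc (sym toℕ-rOF))
    ; p       = rCF
    ; q       = qF
    ; cc      = ccF
    ; leading = leading
    ; closing = closing
    ; E-lower = proj₁ (proj₂ values)
    ; E-upper = proj₂ (proj₂ values)
    ; k-val   = trans (cong (k ℕ.+_) toℕ-rOF) (ℕₚ.m+[n∸m]≡n (proj₂ (proj₁ C)))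
    ; a-val   = λ i → subst (λ i′ → Σ (Fin n) λ x → LeftmostOneAt N (opposite i) x × (+ a i′ ≡ belowLeft N (opposite i) x))
                            (Finₚ.opposite-involutive i) (row-value (opposite i))
    ; b-val   = sym (proj₁ values)
    ; β-val   = cancel (+ β) ℓ
    }
    where
    cancel : ∀ x l → x ≡ (x - l) + l
    cancel = solve-∀

mainTheorem6 : (n k : ℕ) (a : Fin n → ℕ) (b β : ℕ) →
    ((Σ (Matrix n) λ N → Σ ℤ λ E → HasGIT N E k a b β) ×
     (∀ N E N′ E′ → HasGIT N E k a b β → HasGIT N′ E′ k a b β →
        (∀ i j → N i j ≡ N′ i j) × E ≡ E′))
    ⇔ GITConditions n k a b β
mainTheorem6 n k a b β = mk⇔
  (λ ((_ , _ , H) , _) → Analysis.conditions H)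
  (λ C → (Construction.N C , Construction.E C , Construction.hasGIT C)
       , λ _ _ _ _ H H′ → Uniqueness.N≗N′ H H′ , Uniqueness.E≡E′ H H′)
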